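{- As formal power series in $q$ (and for $|q|<1$), \[ \sum_{n\ge0} r_{1,2}(n)q^n=\sum_{n\ge1}\frac{n q^{n^2}}{(q;q)_n}-\sum_{n\ge1}\frac{q^{n^2}}{(q;q)_{n-1}}, \] \[ \sum_{n\ge0} r_{2,2}(n)q^n=\frac{1}{(q,q^4;q^5)_\infty}\left(\frac{q^4+q^6}{1-q^5}+\frac{q^2+q^8}{1-q^{10}}\right). \]
   Context: $(a;q)_n=\prod_{i=0}^{n-1}(1-aq^i)$, $(a;q)_\infty=\prod_{i\ge0}(1-aq^i)$, and $(a_1,a_2;q)_\infty=(a_1;q)_\infty(a_2;q)_\infty$. A partition $\lambda=(\lambda_1\ge\cdots\ge\lambda_k)$ has conjugate $\lambda'$ with $\lambda'_j=\#\{i:\lambda_i\ge j\}$; the hook length of cell $(i,j)$ is $\lambda_i+\lambda'_j-i-j+1$, and a $t$-hook is a cell of hook length $t$. $r_{1,2}(n)$ is the total number of $2$-hooks over all partitions of $n$ whose consecutive parts differ by at least $2$; $r_{2,2}(n)$ is the total number of $2$-hooks over all partitions of $n$ with all parts congruent to $1$ or $4$ modulo $5$. -}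

module Defs where

open import Data.Nat as ℕ using (ℕ; zero; suc; _∸_; _⊓_; _%_; NonZero)
import Data.Nat.Properties as ℕP
open import Data.Integer as ℤ using (ℤ; +_; _+_; _-_; _*_)
open import Data.List using (List; []; _∷_; map; concatMap; applyUpTo; upTo; foldr; length; filter)
open import Data.Bool using (Bool; true; false; if_then_else_; _∧_; _∨_)
open import Relation.Nullary.Decidable using (⌊_⌋)
open import Relation.Binary.PropositionalEquality using (_≡_)

-- A partition is a list (λ₁ ≥ λ₂ ≥ ... ≥ λ_k) of positive integers.
-- parts f n m : all nonincreasing lists of positive integers with sum n
-- and all parts ≤ m (f is fuel; f ≥ n suffices, since each part is ≥ 1).
parts : ℕ → ℕ → ℕ → List (List ℕ)
parts _       zero    m = [] ∷ []
parts zero    (suc n) m = []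
parts (suc f) (suc n) m =
  concatMap (λ p → map (p ∷_) (parts f (suc n ∸ p) p)) (applyUpTo suc (m ⊓ suc n))

partitions : ℕ → List (List ℕ)
partitions n = parts n n n

conj : List ℕ → ℕ → ℕ
conj λs j = length (filter (λ x → j ℕ.≤? x) λs)

-- number of cells (i,j) (1-indexed, 1 ≤ j ≤ λ_i) of λ whose hook length
-- λ_i + λ'_j - i - j + 1 equals t
hooksOfLength : ℕ → List ℕ → ℕ
hooksOfLength t λs = go 1 λs
  where
  row : ℕ → ℕ → ℕ
  row i li = length (filter (λ j → (li ℕ.+ conj λs j ℕ.+ 1) ∸ (i ℕ.+ j) ℕ.≟ t) (applyUpTo suc li))
  go : ℕ → List ℕ → ℕ
  go i []        = 0
  go i (li ∷ ls) = row i li ℕ.+ go (suc i) ls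

gap2 : List ℕ → Bool
gap2 []             = true
gap2 (x ∷ [])       = true
gap2 (x ∷ y ∷ ys)   = ⌊ (y ℕ.+ 2) ℕ.≤? x ⌋ ∧ gap2 (y ∷ ys)

parts14mod5 : List ℕ → Bool
parts14mod5 []       = true
parts14mod5 (x ∷ xs) = (⌊ x % 5 ℕ.≟ 1 ⌋ ∨ ⌊ x % 5 ℕ.≟ 4 ⌋) ∧ parts14mod5 xs

sumℕ : List ℕ → ℕ
sumℕ = foldr ℕ._+_ 0

r : (List ℕ → Bool) → ℕ → ℕ
r P n = sumℕ (map (hooksOfLength 2) (filter (λ λs → Data.Bool._≟_ (P λs) true) (partitions n)))
  where import Data.Bool

r₁₂ r₂₂ : ℕ → ℕ
r₁₂ = r gap2
r₂₂ = r parts14mod5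

FPS : Set
FPS = ℕ → ℤ

sumℤ : List ℤ → ℤ
sumℤ = foldr _+_ (+ 0)

_⊕_ _⊖_ _⊛_ : FPS → FPS → FPS
(f ⊕ g) n = f n + g n
(f ⊖ g) n = f n - g n
(f ⊛ g) n = sumℤ (map (λ k → f k * g (n ∸ k)) (upTo (suc n)))

infixl 6 _⊕_ _⊖_
infixl 7 _⊛_

const : ℤ → FPS
const c zero    = c
const c (suc _) = + 0

mono : ℕ → FPS
mono k n = if ⌊ n ℕ.≟ k ⌋ then + 1 else + 0

scale : ℤ → FPS → FPS
scale c f n = c * f n

-- 1/(1 - q^k), k ≥ 1: the series Σ_{m≥0} q^{km}
geom : (k : ℕ) → .{{NonZero k}} → FPS
geom k n = if ⌊ n % k ℕ.≟ 0 ⌋ then + 1 else + 0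

prodL : List FPS → FPS
prodL = foldr _⊛_ (const (+ 1))

-- 1/(q;q)_n = ∏_{i=1}^{n} 1/(1 - q^i)
invPoch : ℕ → FPS
invPoch n = prodL (map (λ i → geom (suc i)) (upTo n))

-- ∏_{k ≥ 1, S k} 1/(1 - q^k).  The coefficient of q^N only depends on the
-- factors with k ≤ N (the others are ≡ 1 mod q^{N+1}), so it is the
-- coefficient of q^N of the finite product over 1 ≤ k ≤ N.
infProdInv : (ℕ → Bool) → FPS
infProdInv S N =
  prodL (map (λ i → geom (suc i)) (filter (λ i → Data.Bool._≟_ (S (suc i)) true) (upTo N))) N
  where import Data.Bool

-- Σ_{n ≥ 0} F n for a family with F n ≡ 0 mod q^n (order ≥ n):
-- the coefficient of q^N is the finite sum over n ≤ N.
infSum : (ℕ → FPS) → FPS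
infSum F N = sumℤ (map (λ n → F n N) (upTo (suc N)))

genR : (ℕ → ℕ) → FPS
genR rr n = + rr n

term₁ : ℕ → FPS
term₁ zero    = const (+ 0)
term₁ (suc m) = scale (+ suc m) (mono (suc m ℕ.* suc m) ⊛ invPoch (suc m))

term₂ : ℕ → FPS
term₂ zero    = const (+ 0)
term₂ (suc m) = mono (suc m ℕ.* suc m) ⊛ invPoch m

rhs₁ : FPS
rhs₁ = infSum term₁ ⊖ infSum term₂

is14 : ℕ → Bool
is14 k = ⌊ k % 5 ℕ.≟ 1 ⌋ ∨ ⌊ k % 5 ℕ.≟ 4 ⌋

rhs₂ : FPS
rhs₂ = infProdInv is14 ⊛ ((mono 4 ⊕ mono 6) ⊛ geom 5 ⊕ (mono 2 ⊕ mono 8) ⊛ geom 10)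

{-# OPTIONS --safe #-}
-- Every count is a sum over partitions computed by recursion on the largest part, and two
-- counts are equal once they satisfy the same such recursion with the same initial values.
--
-- In a partition into parts ≡ 1, 4 (mod 5) distinct parts differ by at least 2, so the 2-hooks
-- in the rows of length v are an arm-1 hook in the last such row, when v ≥ 2, and a leg-1 hook
-- ending the last-but-one such row, when v occurs at least twice. Summed over all partitions
-- this gives q^v/(q,q^4;q^5)_∞ for every allowed v ≥ 2 and q^(2v)/(q,q^4;q^5)_∞ for every
-- allowed v, which add up to the second identity.
--
-- In a partition into parts differing by at least 2 every part v ≥ 2 carries exactly one 2-hook,
-- so there are as many 2-hooks as parts, less one if the smallest part is 1. Removing the
-- staircase 2k - 1, …, 3, 1 from such a partition with k parts leaves an arbitrary partition into
-- at most k parts, which gives q^(k²)/(q;q)_k, and q^(k²)/(q;q)_(k-1) when the smallest part is 1.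
module Submission where

open import Defs
open import Data.Nat
open import Data.Nat.Properties
open import Data.Nat.DivMod
open import Data.Nat.Induction using (<-rec)
open import Data.Nat.ListAction using (sum)
open import Data.Nat.ListAction.Properties using (sum-++)
open import Data.List using (List; []; _∷_; _++_; map; concatMap; applyUpTo; upTo; filter; length)
open import Data.List.Relation.Unary.All using (universal)
open import Data.List.Properties
  using (filter-all; filter-++; filter-accept; filter-reject; map-++; map-applyUpTo; map-upTo; map-∘; applyUpTo-∷ʳ; upTo-∷ʳ; ++-identityʳ)
open import Data.Integer using (ℤ)
import Data.Integer as ℤ
import Data.Integer.Properties as ℤP
open import Data.Bool using (Bool; true; false; if_then_else_; _∧_; _∨_; T)
import Data.Bool as Bool
open import Data.Bool.Properties using (T-≡)
open import Data.Product using (_×_; _,_; proj₁; proj₂; Σ-syntax)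
open import Data.Sum using (_⊎_; inj₁; inj₂)
open import Data.Unit using (⊤; tt)
open import Data.Empty using (⊥-elim)
open import Function using (_∘_; case_of_; Equivalence)
open import Relation.Nullary using (¬_; Dec; yes; no)
open import Relation.Nullary.Decidable using (⌊_⌋; isYes≗does)
open import Relation.Binary.PropositionalEquality
open import Data.Nat.Solver using (module +-*-Solver)
open +-*-Solver using (solve; _:=_; _:+_; _:*_; con)
open import Algebra.Properties.CommutativeSemigroup +-commutativeSemigroup using (interchange)
open ≡-Reasoning

infixr 8 [_]·_

[_]·_ : Bool → ℕ → ℕ
[ b ]· x = if b then x else 0

[]·-zero : ∀ b → [ b ]· 0 ≡ 0
[]·-zero true  = refl
[]·-zero false = refl

[]·-distrib-+ : ∀ b x y → [ b ]· (x + y) ≡ [ b ]· x + [ b ]· y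
[]·-distrib-+ true  x y = refl
[]·-distrib-+ false x y = refl

[]·-comm : ∀ b c x → [ b ]· [ c ]· x ≡ [ c ]· [ b ]· x
[]·-comm true  c     x = refl
[]·-comm false true  x = refl
[]·-comm false false x = refl

[]·-∧ : ∀ b c x → [ b ∧ c ]· x ≡ [ b ]· [ c ]· x
[]·-∧ true  c x = refl
[]·-∧ false c x = refl

[]·-*-assoc : ∀ b x y → [ b ]· x * y ≡ [ b ]· (x * y)
[]·-*-assoc true  x y = refl
[]·-*-assoc false x y = refl

[]·1-* : ∀ b x → [ b ]· 1 * x ≡ [ b ]· x
[]·1-* true  x = +-identityʳ x
[]·1-* false x = refl

[]·-cong : ∀ b {x y} → (b ≡ true → x ≡ y) → [ b ]· x ≡ [ b ]· y
[]·-cong true  x≡y = x≡y refl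
[]·-cong false x≡y = refl

T⇒≡true : ∀ {b} → T b → b ≡ true
T⇒≡true = Equivalence.to T-≡

¬T⇒≡false : ∀ {b} → ¬ T b → b ≡ false
¬T⇒≡false {true}  ¬b = ⊥-elim (¬b tt)
¬T⇒≡false {false} ¬b = refl

≤ᵇ-true : ∀ {m n} → m ≤ n → (m ≤ᵇ n) ≡ true
≤ᵇ-true = T⇒≡true ∘ ≤⇒≤ᵇ

≤ᵇ-false : ∀ {m n} → n < m → (m ≤ᵇ n) ≡ false
≤ᵇ-false {m} {n} n<m = ¬T⇒≡false (<⇒≱ n<m ∘ ≤ᵇ⇒≤ m n)

≤ᵇ-sound : ∀ {m n} → (m ≤ᵇ n) ≡ true → m ≤ n
≤ᵇ-sound {m} {n} eq = ≤ᵇ⇒≤ m n (Equivalence.from T-≡ eq)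

≡ᵇ-true : ∀ {m n} → m ≡ n → (m ≡ᵇ n) ≡ true
≡ᵇ-true {m} {n} eq = T⇒≡true (≡⇒≡ᵇ m n eq)

≡ᵇ-false : ∀ {m n} → m ≢ n → (m ≡ᵇ n) ≡ false
≡ᵇ-false {m} {n} m≢n = ¬T⇒≡false (m≢n ∘ ≡ᵇ⇒≡ m n)

≡ᵇ-sound : ∀ {m n} → (m ≡ᵇ n) ≡ true → m ≡ n
≡ᵇ-sound {m} {n} eq = ≡ᵇ⇒≡ m n (Equivalence.from T-≡ eq)

≡ᵇ-sym : ∀ m n → (m ≡ᵇ n) ≡ (n ≡ᵇ m)
≡ᵇ-sym zero    zero    = refl
≡ᵇ-sym zero    (suc n) = refl
≡ᵇ-sym (suc m) zero    = refl
≡ᵇ-sym (suc m) (suc n) = ≡ᵇ-sym m n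

∧-true : ∀ {a b} → (a ∧ b) ≡ true → a ≡ true × b ≡ true
∧-true {true} {true} _ = refl , refl

≤ᵇ-suc : ∀ m n → (suc m ≤ᵇ suc n) ≡ (m ≤ᵇ n)
≤ᵇ-suc zero    n = refl
≤ᵇ-suc (suc m) n = refl

≤ᵇ-+ : ∀ a b n → (a + b ≤ᵇ n) ≡ ((a ≤ᵇ n) ∧ (b ≤ᵇ n ∸ a))
≤ᵇ-+ zero    b n       = refl
≤ᵇ-+ (suc a) b zero    = refl
≤ᵇ-+ (suc a) b (suc n) = trans (≤ᵇ-suc (a + b) n) (trans (≤ᵇ-+ a b n) (cong (_∧ (b ≤ᵇ n ∸ a)) (sym (≤ᵇ-suc a n))))

-- [ a ≤ᵇ n ]· F (n ∸ a) is the coefficient of q^n in q^a F(q).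

[]·-shift-+ : ∀ a b n (F : ℕ → ℕ) →
  [ a + b ≤ᵇ n ]· F (n ∸ (a + b)) ≡ [ a ≤ᵇ n ]· [ b ≤ᵇ n ∸ a ]· F (n ∸ a ∸ b)
[]·-shift-+ a b n F = begin
  [ a + b ≤ᵇ n ]· F (n ∸ (a + b))            ≡⟨ cong₂ [_]·_ (≤ᵇ-+ a b n) (cong F (sym (∸-+-assoc n a b))) ⟩
  [ (a ≤ᵇ n) ∧ (b ≤ᵇ n ∸ a) ]· F (n ∸ a ∸ b) ≡⟨ []·-∧ (a ≤ᵇ n) _ _ ⟩
  [ a ≤ᵇ n ]· [ b ≤ᵇ n ∸ a ]· F (n ∸ a ∸ b)  ∎

[]·-shift-comm : ∀ a b n (F : ℕ → ℕ) →
  [ a ≤ᵇ n ]· [ b ≤ᵇ n ∸ a ]· F (n ∸ a ∸ b) ≡ [ b ≤ᵇ n ]· [ a ≤ᵇ n ∸ b ]· F (n ∸ b ∸ a)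
[]·-shift-comm a b n F = begin
  [ a ≤ᵇ n ]· [ b ≤ᵇ n ∸ a ]· F (n ∸ a ∸ b) ≡⟨ []·-shift-+ a b n F ⟨
  [ a + b ≤ᵇ n ]· F (n ∸ (a + b))           ≡⟨ cong (λ k → [ k ≤ᵇ n ]· F (n ∸ k)) (+-comm a b) ⟩
  [ b + a ≤ᵇ n ]· F (n ∸ (b + a))           ≡⟨ []·-shift-+ b a n F ⟩
  [ b ≤ᵇ n ]· [ a ≤ᵇ n ∸ b ]· F (n ∸ b ∸ a) ∎

[]·-shift-merge : ∀ a b c n (F : ℕ → ℕ) → a + b ≡ c →
  [ a ≤ᵇ n ]· [ b ≤ᵇ n ∸ a ]· F (n ∸ a ∸ b) ≡ [ c ≤ᵇ n ]· F (n ∸ c)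
[]·-shift-merge a b c n F refl = sym ([]·-shift-+ a b n F)

∑< : ℕ → (ℕ → ℕ) → ℕ
∑< zero    f = 0
∑< (suc n) f = f 0 + ∑< n (f ∘ suc)

syntax ∑< n (λ i → e) = ∑[ i < n ] e

∑-cong : ∀ n {f g : ℕ → ℕ} → (∀ i → i < n → f i ≡ g i) → ∑< n f ≡ ∑< n g
∑-cong zero    f≡g = refl
∑-cong (suc n) f≡g = cong₂ _+_ (f≡g 0 z<s) (∑-cong n (λ i i<n → f≡g (suc i) (s<s i<n)))

∑-zero : ∀ n {f : ℕ → ℕ} → (∀ i → i < n → f i ≡ 0) → ∑< n f ≡ 0
∑-zero zero    f≡0 = refl
∑-zero (suc n) f≡0 = cong₂ _+_ (f≡0 0 z<s) (∑-zero n (λ i i<n → f≡0 (suc i) (s<s i<n)))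

∑-suc : ∀ n (f : ℕ → ℕ) → ∑< (suc n) f ≡ ∑< n f + f n
∑-suc zero    f = +-comm (f 0) 0
∑-suc (suc n) f = begin
  f 0 + ∑< (suc n) (f ∘ suc)         ≡⟨ cong (f 0 +_) (∑-suc n (f ∘ suc)) ⟩
  f 0 + (∑< n (f ∘ suc) + f (suc n)) ≡⟨ +-assoc (f 0) _ _ ⟨
  f 0 + ∑< n (f ∘ suc) + f (suc n)   ∎

∑-+ : ∀ n (f g : ℕ → ℕ) → ∑[ i < n ] (f i + g i) ≡ ∑< n f + ∑< n g
∑-+ zero    f g = refl
∑-+ (suc n) f g = trans (cong (f 0 + g 0 +_) (∑-+ n (f ∘ suc) (g ∘ suc))) (interchange (f 0) (g 0) _ _)

∑-*ˡ : ∀ n c (f : ℕ → ℕ) → ∑[ i < n ] (c * f i) ≡ c * ∑< n f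
∑-*ˡ zero    c f = sym (*-zeroʳ c)
∑-*ˡ (suc n) c f = trans (cong (c * f 0 +_) (∑-*ˡ n c (f ∘ suc))) (sym (*-distribˡ-+ c (f 0) _))

∑-*ʳ : ∀ n c (f : ℕ → ℕ) → ∑[ i < n ] (f i * c) ≡ ∑< n f * c
∑-*ʳ n c f = begin
  ∑[ i < n ] (f i * c) ≡⟨ ∑-cong n (λ i _ → *-comm (f i) c) ⟩
  ∑[ i < n ] (c * f i) ≡⟨ ∑-*ˡ n c f ⟩
  c * ∑< n f           ≡⟨ *-comm c _ ⟩
  ∑< n f * c           ∎

∑-[]· : ∀ b n (f : ℕ → ℕ) → [ b ]· ∑< n f ≡ ∑[ i < n ] ([ b ]· f i)
∑-[]· true  n f = refl
∑-[]· false n f = sym (∑-zero n (λ _ _ → refl))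

∑-++ : ∀ a b (f : ℕ → ℕ) → ∑< (a + b) f ≡ ∑< a f + ∑[ i < b ] f (a + i)
∑-++ zero    b f = refl
∑-++ (suc a) b f = trans (cong (f 0 +_) (∑-++ a b (f ∘ suc))) (sym (+-assoc (f 0) _ _))

∑-comm : ∀ a b (f : ℕ → ℕ → ℕ) → ∑[ i < a ] ∑[ j < b ] f i j ≡ ∑[ j < b ] ∑[ i < a ] f i j
∑-comm zero    b f = sym (∑-zero b (λ _ _ → refl))
∑-comm (suc a) b f = begin
  ∑[ j < b ] f 0 j + ∑[ i < a ] ∑[ j < b ] f (suc i) j ≡⟨ cong (∑[ j < b ] f 0 j +_) (∑-comm a b (f ∘ suc)) ⟩
  ∑[ j < b ] f 0 j + ∑[ j < b ] ∑[ i < a ] f (suc i) j ≡⟨ ∑-+ b _ _ ⟨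
  ∑[ j < b ] ∑[ i < suc a ] f i j                      ∎

∑-reverse : ∀ n (f : ℕ → ℕ) → ∑< (suc n) f ≡ ∑[ k < suc n ] f (n ∸ k)
∑-reverse zero    f = refl
∑-reverse (suc n) f = begin
  ∑< (suc (suc n)) f                      ≡⟨ ∑-suc (suc n) f ⟩
  ∑< (suc n) f + f (suc n)                ≡⟨ cong (_+ f (suc n)) (∑-reverse n f) ⟩
  ∑[ k < suc n ] f (n ∸ k) + f (suc n)    ≡⟨ +-comm _ (f (suc n)) ⟩
  ∑[ k < suc (suc n) ] f (suc n ∸ k)      ∎

∑-indicator : ∀ n c (f : ℕ → ℕ) → ∑[ i < n ] ([ i ≡ᵇ c ]· f i) ≡ [ suc c ≤ᵇ n ]· f c
∑-indicator zero    c       f = refl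
∑-indicator (suc n) zero    f = trans (cong (f 0 +_) (∑-zero n (λ _ _ → refl))) (+-identityʳ _)
∑-indicator (suc n) (suc c) f = ∑-indicator n c (f ∘ suc)

monomial : ℕ → ℕ → ℕ
monomial a n = [ n ≡ᵇ a ]· 1

-- geometric k is 1/(1 - q^(k + 1)).
geometric : ℕ → ℕ → ℕ
geometric k n = [ n % suc k ≡ᵇ 0 ]· 1

infixl 7 _∗_

_∗_ : (ℕ → ℕ) → (ℕ → ℕ) → ℕ → ℕ
(f ∗ g) n = ∑[ k < suc n ] (f k * g (n ∸ k))

∏ : List (ℕ → ℕ) → ℕ → ℕ
∏ []       = monomial 0
∏ (f ∷ fs) = f ∗ ∏ fs

monomial-∗ : ∀ a g n → (monomial a ∗ g) n ≡ [ a ≤ᵇ n ]· g (n ∸ a)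
monomial-∗ a g n = begin
  ∑[ k < suc n ] ([ k ≡ᵇ a ]· 1 * g (n ∸ k)) ≡⟨ ∑-cong (suc n) (λ k _ → []·1-* (k ≡ᵇ a) (g (n ∸ k))) ⟩
  ∑[ k < suc n ] ([ k ≡ᵇ a ]· g (n ∸ k))     ≡⟨ ∑-indicator (suc n) a (λ k → g (n ∸ k)) ⟩
  [ suc a ≤ᵇ suc n ]· g (n ∸ a)              ≡⟨ cong (λ b → [ b ]· g (n ∸ a)) (≤ᵇ-suc a n) ⟩
  [ a ≤ᵇ n ]· g (n ∸ a)                      ∎

∗-identityʳ : ∀ f n → (f ∗ monomial 0) n ≡ f n
∗-identityʳ f n = begin
  ∑[ k < suc n ] (f k * monomial 0 (n ∸ k)) ≡⟨ ∑-cong (suc n) (λ k k≤n → unit-at k (≤-pred k≤n)) ⟩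
  ∑[ k < suc n ] ([ k ≡ᵇ n ]· f k)          ≡⟨ ∑-indicator (suc n) n f ⟩
  [ suc n ≤ᵇ suc n ]· f n                   ≡⟨ cong (λ b → [ b ]· f n) (≤ᵇ-true (≤-refl {suc n})) ⟩
  f n                                       ∎
  where
  unit-pos : ∀ {x} → 0 < x → monomial 0 x ≡ 0
  unit-pos (s≤s _) = refl
  unit-at : ∀ k → k ≤ n → f k * monomial 0 (n ∸ k) ≡ [ k ≡ᵇ n ]· f k
  unit-at k k≤n with m≤n⇒m<n∨m≡n k≤n
  ... | inj₁ k<n rewrite ≡ᵇ-false (<⇒≢ k<n) | unit-pos (m<n⇒0<n∸m k<n) = *-zeroʳ (f k)
  ... | inj₂ refl rewrite n∸n≡0 k | ≡ᵇ-true (refl {x = k}) = *-identityʳ (f k)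

geometric-rec : ∀ k n → geometric k n ≡ monomial 0 n + [ suc k ≤ᵇ n ]· geometric k (n ∸ suc k)
geometric-rec k zero    = refl
geometric-rec k (suc n) with suc n <? suc k
... | yes n<k = begin
  [ suc n % suc k ≡ᵇ 0 ]· 1                        ≡⟨ cong (λ r → [ r ≡ᵇ 0 ]· 1) (m<n⇒m%n≡m n<k) ⟩
  0                                                ≡⟨ cong (λ b → [ b ]· geometric k (n ∸ k)) (≤ᵇ-false n<k) ⟨
  [ suc k ≤ᵇ suc n ]· geometric k (n ∸ k)          ∎
... | no n≮k = begin
  [ suc n % suc k ≡ᵇ 0 ]· 1                        ≡⟨ cong (λ m → [ m % suc k ≡ᵇ 0 ]· 1) (m∸n+n≡m k≤n) ⟨
  [ (suc n ∸ suc k + suc k) % suc k ≡ᵇ 0 ]· 1      ≡⟨ cong (λ r → [ r ≡ᵇ 0 ]· 1) ([m+n]%n≡m%n (suc n ∸ suc k) (suc k)) ⟩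
  geometric k (n ∸ k)                              ≡⟨ cong (λ b → [ b ]· geometric k (n ∸ k)) (≤ᵇ-true k≤n) ⟨
  [ suc k ≤ᵇ suc n ]· geometric k (n ∸ k)          ∎
  where k≤n = ≮⇒≥ n≮k

∗-distribʳ-+ : ∀ f g h n → ((λ k → f k + g k) ∗ h) n ≡ (f ∗ h) n + (g ∗ h) n
∗-distribʳ-+ f g h n = trans (∑-cong (suc n) (λ k _ → *-distribʳ-+ (h (n ∸ k)) (f k) (g k)))
                             (∑-+ (suc n) (λ k → f k * h (n ∸ k)) (λ k → g k * h (n ∸ k)))

∗-comm : ∀ f g n → (f ∗ g) n ≡ (g ∗ f) n
∗-comm f g n = begin
  ∑[ k < suc n ] (f k * g (n ∸ k))                   ≡⟨ ∑-reverse n (λ k → f k * g (n ∸ k)) ⟩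
  ∑[ k < suc n ] (f (n ∸ k) * g (n ∸ (n ∸ k)))       ≡⟨ ∑-cong (suc n) (λ k k≤n → trans (cong (λ j → f (n ∸ k) * g j) (m∸[m∸n]≡n (≤-pred k≤n)))
                                                                                  (*-comm (f (n ∸ k)) (g k))) ⟩
  ∑[ k < suc n ] (g k * f (n ∸ k))                   ∎

∗-shift : ∀ K (x y z : ℕ → ℕ) → (∀ n → y n ≡ z n + [ K ≤ᵇ n ]· y (n ∸ K)) →
          ∀ n → (x ∗ y) n ≡ (x ∗ z) n + [ K ≤ᵇ n ]· (x ∗ y) (n ∸ K)
∗-shift K x y z y≡ n = begin
  ∑[ j < suc n ] (x j * y (n ∸ j))
    ≡⟨ ∑-cong (suc n) (λ j _ → trans (cong (x j *_) (y≡ (n ∸ j))) (*-distribˡ-+ (x j) (z (n ∸ j)) _)) ⟩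
  ∑[ j < suc n ] (x j * z (n ∸ j) + shifted n j)
    ≡⟨ ∑-+ (suc n) (λ j → x j * z (n ∸ j)) (shifted n) ⟩
  (x ∗ z) n + ∑< (suc n) (shifted n)
    ≡⟨ cong ((x ∗ z) n +_) (∑-shifted (K ≤? n)) ⟩
  (x ∗ z) n + [ K ≤ᵇ n ]· (x ∗ y) (n ∸ K) ∎
  where
  shifted : ℕ → ℕ → ℕ
  shifted n j = x j * [ K ≤ᵇ n ∸ j ]· y (n ∸ j ∸ K)

  shifted-low : ∀ n j → n < K → shifted n j ≡ 0
  shifted-low n j n<K rewrite ≤ᵇ-false {K} (≤-<-trans (m∸n≤m n j) n<K) = *-zeroʳ (x j)

  ∑-shifted-high : ∀ m → ∑< (suc m + K) (shifted (m + K)) ≡ (x ∗ y) m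
  ∑-shifted-high m = begin
    ∑< (suc m + K) (shifted (m + K))                               ≡⟨ ∑-++ (suc m) K (shifted (m + K)) ⟩
    ∑< (suc m) (shifted (m + K)) + ∑[ i < K ] shifted (m + K) (suc m + i)
      ≡⟨ cong₂ _+_ (∑-cong (suc m) (λ j j≤m → main j (≤-pred j≤m))) (∑-zero K (λ i i<K → tail i i<K)) ⟩
    (x ∗ y) m + 0                                                  ≡⟨ +-identityʳ _ ⟩
    (x ∗ y) m                                                      ∎
    where
    main : ∀ j → j ≤ m → shifted (m + K) j ≡ x j * y (m ∸ j)
    main j j≤m rewrite +-∸-comm K j≤m | ≤ᵇ-true (m≤n+m K (m ∸ j)) | m+n∸n≡m (m ∸ j) K = refl
    tail : ∀ i → i < K → shifted (m + K) (suc m + i) ≡ 0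
    tail i i<K rewrite sym (+-suc m i) | [m+n]∸[m+o]≡n∸o m K (suc i)
                     | ≤ᵇ-false {K} (∸-monoʳ-< {K} z<s i<K) = *-zeroʳ (x (m + suc i))

  ∑-shifted : Dec (K ≤ n) → ∑< (suc n) (shifted n) ≡ [ K ≤ᵇ n ]· (x ∗ y) (n ∸ K)
  ∑-shifted (yes K≤n) = begin
    ∑< (suc n) (shifted n)                   ≡⟨ cong (λ m → ∑< (suc m) (shifted m)) (m∸n+n≡m K≤n) ⟨
    ∑< (suc (n ∸ K) + K) (shifted (n ∸ K + K)) ≡⟨ ∑-shifted-high (n ∸ K) ⟩
    (x ∗ y) (n ∸ K)                          ≡⟨ cong (λ b → [ b ]· (x ∗ y) (n ∸ K)) (≤ᵇ-true K≤n) ⟨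
    [ K ≤ᵇ n ]· (x ∗ y) (n ∸ K)              ∎
  ∑-shifted (no K≰n) = trans (∑-zero (suc n) (λ j _ → shifted-low n j (≰⇒> K≰n)))
                             (cong (λ b → [ b ]· (x ∗ y) (n ∸ K)) (sym (≤ᵇ-false (≰⇒> K≰n))))

∏-geometric-snoc : ∀ fs k n → ∏ (fs ++ geometric k ∷ []) n ≡ ∏ fs n + [ suc k ≤ᵇ n ]· ∏ (fs ++ geometric k ∷ []) (n ∸ suc k)
∏-geometric-snoc []       k n = begin
  (geometric k ∗ monomial 0) n                                          ≡⟨ ∗-identityʳ (geometric k) n ⟩
  geometric k n                                                         ≡⟨ geometric-rec k n ⟩
  monomial 0 n + [ suc k ≤ᵇ n ]· geometric k (n ∸ suc k)                ≡⟨ cong (λ x → monomial 0 n + [ suc k ≤ᵇ n ]· x)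
                                                                             (∗-identityʳ (geometric k) (n ∸ suc k)) ⟨
  monomial 0 n + [ suc k ≤ᵇ n ]· (geometric k ∗ monomial 0) (n ∸ suc k) ∎
∏-geometric-snoc (f ∷ fs) k n = ∗-shift (suc k) f _ (∏ fs) (∏-geometric-snoc fs k) n

-- Sums over partitions, by largest part

IsPartition : ℕ → ℕ → List ℕ → Set
IsPartition n m []       = n ≡ 0
IsPartition n m (x ∷ xs) = 1 ≤ x × x ≤ m × x ≤ n × IsPartition (n ∸ x) x xs

largest : List ℕ → ℕ
largest []      = 0
largest (x ∷ _) = x

largest-≤ : ∀ {n m} μ → IsPartition n m μ → largest μ ≤ m
largest-≤ []      _               = z≤n
largest-≤ (x ∷ μ) (_ , x≤m , _) = x≤m

private
  sumOver : ℕ → (List ℕ → ℕ) → ℕ → ℕ → ℕ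
  sumOver fuel w n m = sum (map w (parts fuel n m))

  sum-map-concatMap : ∀ {A B : Set} (w : B → ℕ) (F : A → List B) xs →
    sum (map w (concatMap F xs)) ≡ sum (map (λ x → sum (map w (F x))) xs)
  sum-map-concatMap w F []       = refl
  sum-map-concatMap w F (x ∷ xs) = begin
    sum (map w (F x ++ concatMap F xs))              ≡⟨ cong sum (map-++ w (F x) _) ⟩
    sum (map w (F x) ++ map w (concatMap F xs))      ≡⟨ sum-++ (map w (F x)) _ ⟩
    sum (map w (F x)) + sum (map w (concatMap F xs)) ≡⟨ cong (sum (map w (F x)) +_) (sum-map-concatMap w F xs) ⟩
    sum (map w (F x)) + sum (map (λ x → sum (map w (F x))) xs) ∎

  sum-applyUpTo : ∀ n (f : ℕ → ℕ) → sum (applyUpTo f n) ≡ ∑< n f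
  sum-applyUpTo zero    f = refl
  sum-applyUpTo (suc n) f = cong (f 0 +_) (sum-applyUpTo n (f ∘ suc))

  sumOver-suc : ∀ fuel w n m → sumOver (suc fuel) w (suc n) m ≡
    ∑[ i < m ⊓ suc n ] sumOver fuel (w ∘ (suc i ∷_)) (n ∸ i) (suc i)
  sumOver-suc fuel w n m = begin
    sum (map w (concatMap F (applyUpTo suc (m ⊓ suc n))))
      ≡⟨ sum-map-concatMap w F (applyUpTo suc (m ⊓ suc n)) ⟩
    sum (map (λ p → sum (map w (F p))) (applyUpTo suc (m ⊓ suc n)))
      ≡⟨ cong sum (map-applyUpTo suc _ (m ⊓ suc n)) ⟩
    sum (applyUpTo (λ i → sum (map w (F (suc i)))) (m ⊓ suc n))
      ≡⟨ sum-applyUpTo (m ⊓ suc n) _ ⟩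
    ∑[ i < m ⊓ suc n ] sum (map w (map (suc i ∷_) (parts fuel (n ∸ i) (suc i))))
      ≡⟨ ∑-cong (m ⊓ suc n) (λ i _ → cong sum (sym (map-∘ (parts fuel (n ∸ i) (suc i))))) ⟩
    ∑[ i < m ⊓ suc n ] sumOver fuel (w ∘ (suc i ∷_)) (n ∸ i) (suc i) ∎
    where F = λ p → map (p ∷_) (parts fuel (suc n ∸ p) p)

  sumOver-cong : ∀ fuel n m {w w′ : List ℕ → ℕ} → n ≤ fuel →
    (∀ μ → IsPartition n m μ → w μ ≡ w′ μ) → sumOver fuel w n m ≡ sumOver fuel w′ n m
  sumOver-cong fuel       zero    m          _            w≡w′ = cong (_+ 0) (w≡w′ [] refl)
  sumOver-cong (suc fuel) (suc n) m {w} {w′} (s≤s n≤fuel) w≡w′ = begin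
    sumOver (suc fuel) w (suc n) m  ≡⟨ sumOver-suc fuel w n m ⟩
    ∑< (m ⊓ suc n) _               ≡⟨ ∑-cong (m ⊓ suc n) (λ i i< → sumOver-cong fuel (n ∸ i) (suc i)
                                        (≤-trans (m∸n≤m n i) n≤fuel)
                                        (λ μ μ⊢ → w≡w′ (suc i ∷ μ) (s≤s z≤n , ≤-trans i< (m⊓n≤m m _) , ≤-trans i< (m⊓n≤n m _) , μ⊢))) ⟩
    ∑< (m ⊓ suc n) _               ≡⟨ sumOver-suc fuel w′ n m ⟨
    sumOver (suc fuel) w′ (suc n) m ∎

  sumOver-fuel : ∀ fuel fuel′ n m (w : List ℕ → ℕ) → n ≤ fuel → n ≤ fuel′ →
    sumOver fuel w n m ≡ sumOver fuel′ w n m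
  sumOver-fuel fuel       fuel′       zero    m w _ _ = refl
  sumOver-fuel (suc fuel) (suc fuel′) (suc n) m w (s≤s n≤fuel) (s≤s n≤fuel′) = begin
    sumOver (suc fuel) w (suc n) m  ≡⟨ sumOver-suc fuel w n m ⟩
    ∑< (m ⊓ suc n) _               ≡⟨ ∑-cong (m ⊓ suc n) (λ i _ → sumOver-fuel fuel fuel′ (n ∸ i) (suc i) _
                                        (≤-trans (m∸n≤m n i) n≤fuel) (≤-trans (m∸n≤m n i) n≤fuel′)) ⟩
    ∑< (m ⊓ suc n) _               ≡⟨ sumOver-suc fuel′ w n m ⟨
    sumOver (suc fuel′) w (suc n) m ∎

partSum : (List ℕ → ℕ) → ℕ → ℕ → ℕ
partSum w n m = sumOver n w n m

partSum-suc : ∀ w n m → partSum w (suc n) m ≡ ∑[ i < m ⊓ suc n ] partSum (w ∘ (suc i ∷_)) (n ∸ i) (suc i)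
partSum-suc w n m = trans (sumOver-suc n w n m)
  (∑-cong (m ⊓ suc n) (λ i _ → sumOver-fuel n (n ∸ i) (n ∸ i) (suc i) _ (m∸n≤m n i) ≤-refl))

partSum-cong : ∀ n m {w w′ : List ℕ → ℕ} → (∀ μ → IsPartition n m μ → w μ ≡ w′ μ) → partSum w n m ≡ partSum w′ n m
partSum-cong n m = sumOver-cong n n m ≤-refl

private
  sum-map-+ : ∀ {A : Set} (f g : A → ℕ) xs → sum (map (λ x → f x + g x) xs) ≡ sum (map f xs) + sum (map g xs)
  sum-map-+ f g []       = refl
  sum-map-+ f g (x ∷ xs) = trans (cong (f x + g x +_) (sum-map-+ f g xs)) (interchange (f x) (g x) _ _)

  sum-map-*ˡ : ∀ {A : Set} c (f : A → ℕ) xs → sum (map (λ x → c * f x) xs) ≡ c * sum (map f xs)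
  sum-map-*ˡ c f []       = sym (*-zeroʳ c)
  sum-map-*ˡ c f (x ∷ xs) = trans (cong (c * f x +_) (sum-map-*ˡ c f xs)) (sym (*-distribˡ-+ c (f x) _))

partSum-+ : ∀ (w w′ : List ℕ → ℕ) n m → partSum (λ μ → w μ + w′ μ) n m ≡ partSum w n m + partSum w′ n m
partSum-+ w w′ n m = sum-map-+ w w′ (parts n n m)

partSum-*ˡ : ∀ c (w : List ℕ → ℕ) n m → partSum (λ μ → c * w μ) n m ≡ c * partSum w n m
partSum-*ˡ c w n m = sum-map-*ˡ c w (parts n n m)

partSum-zero : ∀ n m {w : List ℕ → ℕ} → (∀ μ → IsPartition n m μ → w μ ≡ 0) → partSum w n m ≡ 0
partSum-zero n m {w} w≡0 = begin
  partSum w n m               ≡⟨ partSum-cong n m w≡0 ⟩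
  partSum (λ μ → 0 * w μ) n m ≡⟨ partSum-*ˡ 0 w n m ⟩
  0                           ∎

partSum-[]· : ∀ b (w : List ℕ → ℕ) n m → partSum (λ μ → [ b ]· w μ) n m ≡ [ b ]· partSum w n m
partSum-[]· true  w n m = refl
partSum-[]· false w n m = partSum-zero n m (λ _ _ → refl)

partSum-∑ : ∀ k (w : ℕ → List ℕ → ℕ) n m → partSum (λ μ → ∑[ i < k ] w i μ) n m ≡ ∑[ i < k ] partSum (w i) n m
partSum-∑ zero    w n m = partSum-zero n m (λ _ _ → refl)
partSum-∑ (suc k) w n m =
  trans (partSum-+ (w 0) _ n m) (cong (partSum (w 0) n m +_) (partSum-∑ k (w ∘ suc) n m))

partSum-noParts : ∀ (w : List ℕ → ℕ) n → partSum w (suc n) 0 ≡ 0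
partSum-noParts w n = partSum-suc w n 0

partSum-largest : ∀ (w : List ℕ → ℕ) n m → partSum w n (suc m) ≡
  partSum w n m + [ suc m ≤ᵇ n ]· partSum (w ∘ (suc m ∷_)) (n ∸ suc m) (suc m)
partSum-largest w zero    m = sym (+-identityʳ _)
partSum-largest w (suc n) m with m ≤? n
... | yes m≤n = begin
  partSum w (suc n) (suc m)                  ≡⟨ partSum-suc w n (suc m) ⟩
  ∑< (suc (m ⊓ n)) F                         ≡⟨ cong (λ k → ∑< (suc k) F) (m≤n⇒m⊓n≡m m≤n) ⟩
  ∑< (suc m) F                               ≡⟨ ∑-suc m F ⟩
  ∑< m F + F m                               ≡⟨ cong₂ _+_ (cong (λ k → ∑< k F) (sym (m≤n⇒m⊓n≡m (m≤n⇒m≤1+n m≤n))))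
                                                          (cong (λ b → [ b ]· F m) (sym (≤ᵇ-true (s≤s m≤n)))) ⟩
  ∑< (m ⊓ suc n) F + [ suc m ≤ᵇ suc n ]· F m ≡⟨ cong (_+ [ suc m ≤ᵇ suc n ]· F m) (partSum-suc w n m) ⟨
  partSum w (suc n) m + [ suc m ≤ᵇ suc n ]· F m ∎
  where F = λ i → partSum (w ∘ (suc i ∷_)) (n ∸ i) (suc i)
... | no m≰n = begin
  partSum w (suc n) (suc m)                  ≡⟨ partSum-suc w n (suc m) ⟩
  ∑< (suc (m ⊓ n)) F                         ≡⟨ cong (λ k → ∑< (suc k) F) (m≥n⇒m⊓n≡n (≰⇒≥ m≰n)) ⟩
  ∑< (suc n) F                               ≡⟨ cong (λ k → ∑< k F) (sym (m≥n⇒m⊓n≡n (≰⇒> m≰n))) ⟩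
  ∑< (m ⊓ suc n) F                           ≡⟨ +-identityʳ _ ⟨
  ∑< (m ⊓ suc n) F + 0                       ≡⟨ cong₂ _+_ (partSum-suc w n m)
                                                          (cong (λ b → [ b ]· F m) (≤ᵇ-false (s≤s (≰⇒> m≰n)))) ⟨
  partSum w (suc n) m + [ suc m ≤ᵇ suc n ]· F m ∎
  where F = λ i → partSum (w ∘ (suc i ∷_)) (n ∸ i) (suc i)

partSum-bound : ∀ (w : List ℕ → ℕ) n m → n ≤ m → partSum w n m ≡ partSum w n n
partSum-bound w zero    m _   = refl
partSum-bound w (suc n) m n≤m = begin
  partSum w (suc n) m     ≡⟨ partSum-suc w n m ⟩
  ∑< (m ⊓ suc n) F        ≡⟨ cong (λ k → ∑< k F) (trans (m≥n⇒m⊓n≡n n≤m) (sym (⊓-idem (suc n)))) ⟩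
  ∑< (suc n ⊓ suc n) F    ≡⟨ partSum-suc w n (suc n) ⟨
  partSum w (suc n) (suc n) ∎
  where F = λ i → partSum (w ∘ (suc i ∷_)) (n ∸ i) (suc i)

partSum-restrict : ∀ (w : List ℕ → ℕ) n q m → q ≤ m →
  (∀ μ → IsPartition n m μ → q < largest μ → w μ ≡ 0) → partSum w n m ≡ partSum w n q
partSum-restrict w n q m q≤m w≡0 = go (m ∸ q) m (m∸n+n≡m q≤m) ≤-refl
  where
  go : ∀ d k → d + q ≡ k → k ≤ m → partSum w n k ≡ partSum w n q
  go zero    k       refl _   = refl
  go (suc d) (suc k) d+q≡k k<m = begin
    partSum w n (suc k)     ≡⟨ partSum-largest w n k ⟩
    partSum w n k + [ suc k ≤ᵇ n ]· partSum (w ∘ (suc k ∷_)) (n ∸ suc k) (suc k)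
      ≡⟨ cong (partSum w n k +_) ([]·-cong (suc k ≤ᵇ n) λ k<n → partSum-zero (n ∸ suc k) (suc k) λ μ μ⊢ →
           w≡0 (suc k ∷ μ) (s≤s z≤n , k<m , ≤ᵇ-sound k<n , μ⊢) (subst (q <_) d+q≡k (s≤s (m≤n+m q d)))) ⟩
    partSum w n k + [ suc k ≤ᵇ n ]· 0 ≡⟨ cong (partSum w n k +_) ([]·-zero (suc k ≤ᵇ n)) ⟩
    partSum w n k + 0       ≡⟨ +-identityʳ _ ⟩
    partSum w n k           ≡⟨ go d k (suc-injective d+q≡k) (≤-trans (n≤1+n k) k<m) ⟩
    partSum w n q           ∎

length-≤ : ∀ {n m} λs → IsPartition n m λs → length λs ≤ n
length-≤ []       _                    = z≤n
length-≤ (y ∷ ys) (1≤y , _ , y≤n , μ⊢) = ≤-trans (s≤s (length-≤ ys μ⊢)) (∸-monoʳ-< 1≤y y≤n)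

partSum-byLength : ∀ (w : List ℕ → ℕ) n → partSum w n n ≡ ∑[ k < suc n ] partSum (λ μ → [ length μ ≡ᵇ k ]· w μ) n n
partSum-byLength w n = trans (partSum-cong n n split) (partSum-∑ (suc n) (λ k μ → [ length μ ≡ᵇ k ]· w μ) n n)
  where
  split : ∀ μ → IsPartition n n μ → w μ ≡ ∑[ k < suc n ] ([ length μ ≡ᵇ k ]· w μ)
  split μ μ⊢ = sym (begin
    ∑[ k < suc n ] ([ length μ ≡ᵇ k ]· w μ) ≡⟨ ∑-cong (suc n) (λ k _ → cong ([_]· w μ) (≡ᵇ-sym (length μ) k)) ⟩
    ∑[ k < suc n ] ([ k ≡ᵇ length μ ]· w μ) ≡⟨ ∑-indicator (suc n) (length μ) (λ _ → w μ) ⟩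
    [ suc (length μ) ≤ᵇ suc n ]· w μ        ≡⟨ cong ([_]· w μ) (≤ᵇ-true (s≤s (length-≤ μ μ⊢))) ⟩
    w μ                                     ∎)

module _ (step : ℕ → ℕ → ℕ → ℕ → ℕ) where

  LargestPartRecursion : (ℕ → ℕ → ℕ) → Set
  LargestPartRecursion F = ∀ n m → F n (suc m) ≡ step n m (F n m) ([ suc m ≤ᵇ n ]· F (n ∸ suc m) (suc m))

  largestPartRecursion-unique : ∀ {F F′} → (∀ n → F n 0 ≡ F′ n 0) →
    LargestPartRecursion F → LargestPartRecursion F′ → ∀ n m → F n m ≡ F′ n m
  largestPartRecursion-unique {F} {F′} F≡F′ rec rec′ = <-rec _ go
    where
    go : ∀ n → (∀ {k} → k < n → ∀ m → F k m ≡ F′ k m) → ∀ m → F n m ≡ F′ n m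
    go n ih zero    = F≡F′ n
    go n ih (suc m) = begin
      F n (suc m)                                                   ≡⟨ rec n m ⟩
      step n m (F n m) ([ suc m ≤ᵇ n ]· F (n ∸ suc m) (suc m))      ≡⟨ cong₂ (step n m) (go n ih m)
                                                                         ([]·-cong (suc m ≤ᵇ n) λ m<n →
                                                                           ih (∸-monoʳ-< z<s (≤ᵇ-sound m<n)) (suc m)) ⟩
      step n m (F′ n m) ([ suc m ≤ᵇ n ]· F′ (n ∸ suc m) (suc m))    ≡⟨ rec′ n m ⟨
      F′ n (suc m)                                                  ∎

partitionStep : (ℕ → Bool) → ℕ → ℕ → ℕ → ℕ → ℕ
partitionStep S n m x y = x + [ S (suc m) ]· y

PartitionRecursion : (ℕ → Bool) → (ℕ → ℕ → ℕ) → Set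
PartitionRecursion S = LargestPartRecursion (partitionStep S)

allParts : (ℕ → Bool) → List ℕ → Bool
allParts S []       = true
allParts S (x ∷ xs) = S x ∧ allParts S xs

partitionCount : (ℕ → Bool) → ℕ → ℕ → ℕ
partitionCount S = partSum (λ μ → [ allParts S μ ]· 1)

partitionCount-largest : ∀ S → PartitionRecursion S (partitionCount S)
partitionCount-largest S n m = begin
  partitionCount S n (suc m)                                                    ≡⟨ partSum-largest (λ μ → [ allParts S μ ]· 1) n m ⟩
  partitionCount S n m + [ suc m ≤ᵇ n ]· partSum (λ μ → [ S (suc m) ∧ allParts S μ ]· 1) (n ∸ suc m) (suc m)
    ≡⟨ cong (λ x → partitionCount S n m + [ suc m ≤ᵇ n ]· x) (partSum-cong (n ∸ suc m) (suc m) (λ μ _ → []·-∧ (S (suc m)) _ 1)) ⟩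
  partitionCount S n m + [ suc m ≤ᵇ n ]· partSum (λ μ → [ S (suc m) ]· [ allParts S μ ]· 1) (n ∸ suc m) (suc m)
    ≡⟨ cong (λ x → partitionCount S n m + [ suc m ≤ᵇ n ]· x) (partSum-[]· (S (suc m)) (λ μ → [ allParts S μ ]· 1) (n ∸ suc m) (suc m)) ⟩
  partitionCount S n m + [ suc m ≤ᵇ n ]· [ S (suc m) ]· partitionCount S (n ∸ suc m) (suc m)
    ≡⟨ cong (partitionCount S n m +_) ([]·-comm (suc m ≤ᵇ n) (S (suc m)) _) ⟩
  partitionCount S n m + [ S (suc m) ]· [ suc m ≤ᵇ n ]· partitionCount S (n ∸ suc m) (suc m) ∎

p≤ : ℕ → ℕ → ℕ
p≤ = partitionCount (λ _ → true)

partitionCount-zero : ∀ S n → partitionCount S n 0 ≡ monomial 0 n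
partitionCount-zero S zero    = refl
partitionCount-zero S (suc n) = partSum-noParts (λ μ → [ allParts S μ ]· 1) n

module _ (S : ℕ → Bool) where

  partitionRecursion-+ : ∀ {F G} → PartitionRecursion S F → PartitionRecursion S G →
    PartitionRecursion S (λ n m → F n m + G n m)
  partitionRecursion-+ {F} {G} F-rec G-rec n m = begin
    F n (suc m) + G n (suc m)                                      ≡⟨ cong₂ _+_ (F-rec n m) (G-rec n m) ⟩
    (F n m + [ s ]· [ g ]· F′) + (G n m + [ s ]· [ g ]· G′)        ≡⟨ interchange (F n m) _ (G n m) _ ⟩
    (F n m + G n m) + ([ s ]· [ g ]· F′ + [ s ]· [ g ]· G′)        ≡⟨ cong ((F n m + G n m) +_) (trans
                                                                        (sym ([]·-distrib-+ s _ _)) (cong ([ s ]·_) (sym ([]·-distrib-+ g F′ G′)))) ⟩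
    (F n m + G n m) + [ s ]· [ g ]· (F′ + G′)                      ∎
    where s = S (suc m); g = suc m ≤ᵇ n; F′ = F (n ∸ suc m) (suc m); G′ = G (n ∸ suc m) (suc m)

  partitionRecursion-[]· : ∀ b {F} → PartitionRecursion S F → PartitionRecursion S (λ n m → [ b ]· F n m)
  partitionRecursion-[]· b {F} F-rec n m = begin
    [ b ]· F n (suc m)                              ≡⟨ cong ([ b ]·_) (F-rec n m) ⟩
    [ b ]· (F n m + [ s ]· [ g ]· F′)               ≡⟨ []·-distrib-+ b _ _ ⟩
    [ b ]· F n m + [ b ]· [ s ]· [ g ]· F′          ≡⟨ cong ([ b ]· F n m +_) (trans ([]·-comm b s _) (cong ([ s ]·_) ([]·-comm b g F′))) ⟩
    [ b ]· F n m + [ s ]· [ g ]· [ b ]· F′          ∎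
    where s = S (suc m); g = suc m ≤ᵇ n; F′ = F (n ∸ suc m) (suc m)

  partitionRecursion-shift : ∀ a {F} → PartitionRecursion S F → PartitionRecursion S (λ n m → [ a ≤ᵇ n ]· F (n ∸ a) m)
  partitionRecursion-shift a {F} F-rec n m = begin
    [ a ≤ᵇ n ]· F (n ∸ a) (suc m)                                       ≡⟨ cong ([ a ≤ᵇ n ]·_) (F-rec (n ∸ a) m) ⟩
    [ a ≤ᵇ n ]· (F (n ∸ a) m + [ s ]· [ suc m ≤ᵇ n ∸ a ]· F″)            ≡⟨ []·-distrib-+ (a ≤ᵇ n) _ _ ⟩
    [ a ≤ᵇ n ]· F (n ∸ a) m + [ a ≤ᵇ n ]· [ s ]· [ suc m ≤ᵇ n ∸ a ]· F″ ≡⟨ cong ([ a ≤ᵇ n ]· F (n ∸ a) m +_) (begin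
        [ a ≤ᵇ n ]· [ s ]· [ suc m ≤ᵇ n ∸ a ]· F″                         ≡⟨ []·-comm (a ≤ᵇ n) s _ ⟩
        [ s ]· [ a ≤ᵇ n ]· [ suc m ≤ᵇ n ∸ a ]· F″                         ≡⟨ cong ([ s ]·_) ([]·-shift-comm a (suc m) n (λ k → F k (suc m))) ⟩
        [ s ]· [ suc m ≤ᵇ n ]· [ a ≤ᵇ n ∸ suc m ]· F (n ∸ suc m ∸ a) (suc m) ∎) ⟩
    [ a ≤ᵇ n ]· F (n ∸ a) m + [ s ]· [ suc m ≤ᵇ n ]· [ a ≤ᵇ n ∸ suc m ]· F (n ∸ suc m ∸ a) (suc m) ∎
    where s = S (suc m); F″ = F (n ∸ a ∸ suc m) (suc m)

∏geometric : (ℕ → Bool) → ℕ → ℕ → ℕ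
∏geometric S m = ∏ (map geometric (filter (λ i → S (suc i) Bool.≟ true) (upTo m)))

private
  filter-upTo-suc : ∀ {P : ℕ → Set} (P? : ∀ i → Dec (P i)) m → filter P? (upTo (suc m)) ≡ filter P? (upTo m) ++ filter P? (m ∷ [])
  filter-upTo-suc P? m = trans (cong (filter P?) (sym (upTo-∷ʳ m))) (filter-++ P? (upTo m) (m ∷ []))

∏geometric-largest : ∀ S → PartitionRecursion S (λ n m → ∏geometric S m n)
∏geometric-largest S n m with S (suc m) in Sm
... | true = begin
  ∏geometric S (suc m) n                            ≡⟨ cong (λ fs → ∏ fs n) gs-accept ⟩
  ∏ (gs ++ geometric m ∷ []) n                      ≡⟨ ∏-geometric-snoc gs m n ⟩
  ∏geometric S m n + [ suc m ≤ᵇ n ]· ∏ (gs ++ geometric m ∷ []) (n ∸ suc m)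
    ≡⟨ cong (λ fs → ∏geometric S m n + [ suc m ≤ᵇ n ]· ∏ fs (n ∸ suc m)) gs-accept ⟨
  ∏geometric S m n + [ suc m ≤ᵇ n ]· ∏geometric S (suc m) (n ∸ suc m) ∎
  where
  P? = λ i → S (suc i) Bool.≟ true
  gs = map geometric (filter P? (upTo m))
  gs-accept : map geometric (filter P? (upTo (suc m))) ≡ gs ++ geometric m ∷ []
  gs-accept = trans (cong (map geometric) (trans (filter-upTo-suc P? m) (cong (filter P? (upTo m) ++_) (filter-accept P? Sm))))
                    (map-++ geometric (filter P? (upTo m)) (m ∷ []))
... | false = begin
  ∏geometric S (suc m) n  ≡⟨ cong (λ xs → ∏ (map geometric xs) n) filter-reject-m ⟩
  ∏geometric S m n        ≡⟨ +-identityʳ _ ⟨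
  ∏geometric S m n + 0    ∎
  where
  P? = λ i → S (suc i) Bool.≟ true
  filter-reject-m : filter P? (upTo (suc m)) ≡ filter P? (upTo m)
  filter-reject-m = begin
    filter P? (upTo (suc m))                 ≡⟨ filter-upTo-suc P? m ⟩
    filter P? (upTo m) ++ filter P? (m ∷ []) ≡⟨ cong (filter P? (upTo m) ++_) (filter-reject P? (λ Sm≡true → case trans (sym Sm) Sm≡true of λ ())) ⟩
    filter P? (upTo m) ++ []                 ≡⟨ ++-identityʳ _ ⟩
    filter P? (upTo m)                       ∎

∏geometric≡partitionCount : ∀ S m n → ∏geometric S m n ≡ partitionCount S n m
∏geometric≡partitionCount S m n =
  largestPartRecursion-unique (partitionStep S) {F = λ n m → ∏geometric S m n} {F′ = partitionCount S}
    (λ n → sym (partitionCount-zero S n)) (∏geometric-largest S) (partitionCount-largest S) n m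

boxCount : ℕ → ℕ → ℕ → ℕ
boxCount n m k = partSum (λ μ → [ length μ ≤ᵇ k ]· 1) n m

boxCount-noRows : ∀ n m → boxCount n m 0 ≡ monomial 0 n
boxCount-noRows zero    m = refl
boxCount-noRows (suc n) m = partSum-zero (suc n) m nonempty
  where
  nonempty : ∀ μ → IsPartition (suc n) m μ → [ length μ ≤ᵇ 0 ]· 1 ≡ 0
  nonempty (x ∷ μ) _ = refl

boxCount-noColumns : ∀ n k → boxCount n 0 k ≡ monomial 0 n
boxCount-noColumns zero    k = refl
boxCount-noColumns (suc n) k = partSum-noParts (λ μ → [ length μ ≤ᵇ k ]· 1) n

boxCount-largest : ∀ n m k → boxCount n (suc m) (suc k) ≡ boxCount n m (suc k) + [ suc m ≤ᵇ n ]· boxCount (n ∸ suc m) (suc m) k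
boxCount-largest n m k = trans (partSum-largest (λ μ → [ length μ ≤ᵇ suc k ]· 1) n m)
  (cong (λ x → boxCount n m (suc k) + [ suc m ≤ᵇ n ]· x)
    (partSum-cong (n ∸ suc m) (suc m) (λ μ _ → cong ([_]· 1) (≤ᵇ-suc (length μ) k))))

boxCount-column-width1 : ∀ k n → boxCount n 1 (suc k) ≡ boxCount n 1 k + [ suc k ≤ᵇ n ]· monomial 0 (n ∸ suc k)
boxCount-column-width1 k       zero    = refl
boxCount-column-width1 zero    (suc n) = begin
  boxCount (suc n) 1 1                  ≡⟨ boxCount-largest (suc n) 0 0 ⟩
  boxCount (suc n) 0 1 + boxCount n 1 0 ≡⟨ cong₂ _+_ (boxCount-noColumns (suc n) 1) (boxCount-noRows n 1) ⟩
  monomial 0 n                          ≡⟨ cong (_+ monomial 0 n) (boxCount-noRows (suc n) 1) ⟨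
  boxCount (suc n) 1 0 + monomial 0 n   ∎
boxCount-column-width1 (suc k) (suc n) = begin
  boxCount (suc n) 1 (2 + k)                                ≡⟨ boxCount-largest (suc n) 0 (suc k) ⟩
  boxCount (suc n) 0 (2 + k) + boxCount n 1 (suc k)         ≡⟨ cong₂ _+_ (boxCount-noColumns (suc n) (2 + k)) (boxCount-column-width1 k n) ⟩
  0 + (boxCount n 1 k + ones)                               ≡⟨ cong (_+ (boxCount n 1 k + ones)) (boxCount-noColumns (suc n) (suc k)) ⟨
  boxCount (suc n) 0 (suc k) + (boxCount n 1 k + ones)      ≡⟨ +-assoc (boxCount (suc n) 0 (suc k)) (boxCount n 1 k) ones ⟨
  boxCount (suc n) 0 (suc k) + boxCount n 1 k + ones        ≡⟨ cong (_+ ones) (boxCount-largest (suc n) 0 k) ⟨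
  boxCount (suc n) 1 (suc k) + ones                         ∎
  where ones = [ suc k ≤ᵇ n ]· monomial 0 (n ∸ suc k)

-- A partition with exactly k + 1 parts, all at most M + 1, loses its first column of k + 1 cells.
boxCount-column : ∀ M k n → boxCount n (suc M) (suc k) ≡ boxCount n (suc M) k + [ suc k ≤ᵇ n ]· boxCount (n ∸ suc k) M (suc k)
boxCount-column zero    k       n = trans (boxCount-column-width1 k n)
  (cong (λ x → boxCount n 1 k + [ suc k ≤ᵇ n ]· x) (sym (boxCount-noColumns (n ∸ suc k) (suc k))))
boxCount-column (suc M) zero    n = begin
  boxCount n (2 + M) 1
    ≡⟨ boxCount-largest n (suc M) 0 ⟩
  boxCount n (suc M) 1 + [ 2 + M ≤ᵇ n ]· boxCount (n ∸ (2 + M)) (2 + M) 0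
    ≡⟨ cong₂ (λ x y → x + [ 2 + M ≤ᵇ n ]· y) (boxCount-column M 0 n) (boxCount-noRows (n ∸ (2 + M)) (2 + M)) ⟩
  boxCount n (suc M) 0 + [ 1 ≤ᵇ n ]· boxCount (n ∸ 1) M 1 + [ 2 + M ≤ᵇ n ]· monomial 0 (n ∸ (2 + M))
    ≡⟨ cong₂ (λ x y → x + [ 1 ≤ᵇ n ]· boxCount (n ∸ 1) M 1 + y)
         (trans (boxCount-noRows n (suc M)) (sym (boxCount-noRows n (2 + M))))
         (sym ([]·-shift-merge 1 (suc M) (2 + M) n (monomial 0) refl)) ⟩
  boxCount n (2 + M) 0 + [ 1 ≤ᵇ n ]· boxCount (n ∸ 1) M 1 + [ 1 ≤ᵇ n ]· [ suc M ≤ᵇ n ∸ 1 ]· monomial 0 (n ∸ 1 ∸ suc M)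
    ≡⟨ +-assoc (boxCount n (2 + M) 0) _ _ ⟩
  boxCount n (2 + M) 0 + ([ 1 ≤ᵇ n ]· boxCount (n ∸ 1) M 1 + [ 1 ≤ᵇ n ]· [ suc M ≤ᵇ n ∸ 1 ]· monomial 0 (n ∸ 1 ∸ suc M))
    ≡⟨ cong (boxCount n (2 + M) 0 +_) ([]·-distrib-+ (1 ≤ᵇ n) _ _) ⟨
  boxCount n (2 + M) 0 + [ 1 ≤ᵇ n ]· (boxCount (n ∸ 1) M 1 + [ suc M ≤ᵇ n ∸ 1 ]· monomial 0 (n ∸ 1 ∸ suc M))
    ≡⟨ cong (λ x → boxCount n (2 + M) 0 + [ 1 ≤ᵇ n ]· (boxCount (n ∸ 1) M 1 + [ suc M ≤ᵇ n ∸ 1 ]· x))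
         (boxCount-noRows (n ∸ 1 ∸ suc M) (suc M)) ⟨
  boxCount n (2 + M) 0 + [ 1 ≤ᵇ n ]· (boxCount (n ∸ 1) M 1 + [ suc M ≤ᵇ n ∸ 1 ]· boxCount (n ∸ 1 ∸ suc M) (suc M) 0)
    ≡⟨ cong (λ x → boxCount n (2 + M) 0 + [ 1 ≤ᵇ n ]· x) (boxCount-largest (n ∸ 1) M 0) ⟨
  boxCount n (2 + M) 0 + [ 1 ≤ᵇ n ]· boxCount (n ∸ 1) (suc M) 1 ∎
boxCount-column (suc M) (suc k) n = begin
  boxCount n (2 + M) (2 + k)
    ≡⟨ boxCount-largest n (suc M) (suc k) ⟩
  boxCount n (suc M) (2 + k) + [ 2 + M ≤ᵇ n ]· boxCount n′ (2 + M) (suc k)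
    ≡⟨ cong₂ (λ x y → x + [ 2 + M ≤ᵇ n ]· y) (boxCount-column M (suc k) n) (boxCount-column (suc M) k n′) ⟩
  (a + b) + [ 2 + M ≤ᵇ n ]· (c + [ suc k ≤ᵇ n′ ]· shorter (n′ ∸ suc k))
    ≡⟨ cong ((a + b) +_) ([]·-distrib-+ (2 + M ≤ᵇ n) c _) ⟩
  (a + b) + ([ 2 + M ≤ᵇ n ]· c + [ 2 + M ≤ᵇ n ]· [ suc k ≤ᵇ n′ ]· shorter (n′ ∸ suc k))
    ≡⟨ interchange a b _ _ ⟩
  (a + [ 2 + M ≤ᵇ n ]· c) + (b + [ 2 + M ≤ᵇ n ]· [ suc k ≤ᵇ n′ ]· shorter (n′ ∸ suc k))
    ≡⟨ cong₂ (λ x y → x + (b + y)) (sym (boxCount-largest n (suc M) k))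
         (trans ([]·-shift-merge (2 + M) (suc k) (2 + k + suc M) n shorter swap) ([]·-shift-+ (2 + k) (suc M) n shorter)) ⟩
  boxCount n (2 + M) (suc k) + (b + [ 2 + k ≤ᵇ n ]· [ suc M ≤ᵇ n ∸ (2 + k) ]· shorter (n ∸ (2 + k) ∸ suc M))
    ≡⟨ cong (boxCount n (2 + M) (suc k) +_) ([]·-distrib-+ (2 + k ≤ᵇ n) _ _) ⟨
  boxCount n (2 + M) (suc k) + [ 2 + k ≤ᵇ n ]· (boxCount (n ∸ (2 + k)) M (2 + k) + [ suc M ≤ᵇ n ∸ (2 + k) ]· shorter (n ∸ (2 + k) ∸ suc M))
    ≡⟨ cong (λ x → boxCount n (2 + M) (suc k) + [ 2 + k ≤ᵇ n ]· x) (boxCount-largest (n ∸ (2 + k)) M (suc k)) ⟨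
  boxCount n (2 + M) (suc k) + [ 2 + k ≤ᵇ n ]· boxCount (n ∸ (2 + k)) (suc M) (2 + k) ∎
  where
  n′ = n ∸ (2 + M)
  a = boxCount n (suc M) (suc k)
  b = [ 2 + k ≤ᵇ n ]· boxCount (n ∸ (2 + k)) M (2 + k)
  c = boxCount n′ (2 + M) k
  shorter = λ x → boxCount x (suc M) (suc k)
  swap : (2 + M) + suc k ≡ (2 + k) + suc M
  swap = solve 2 (λ M k → (con 2 :+ M) :+ (con 1 :+ k) := (con 2 :+ k) :+ (con 1 :+ M)) refl M k

boxCount-conjugate : ∀ n k → boxCount n n k ≡ p≤ n k
boxCount-conjugate = largestPartRecursion-unique (partitionStep (λ _ → true)) {λ n k → boxCount n n k}
  (λ n → trans (boxCount-noRows n n) (sym (partitionCount-zero (λ _ → true) n))) diagonal-rec (partitionCount-largest (λ _ → true))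
  where
  diagonal-rec : PartitionRecursion (λ _ → true) (λ n k → boxCount n n k)
  diagonal-rec zero    k = refl
  diagonal-rec (suc n) k = trans (boxCount-column n k (suc n))
    (cong (λ x → boxCount (suc n) (suc n) k + [ suc k ≤ᵇ suc n ]· x) (partSum-bound (λ μ → [ length μ ≤ᵇ suc k ]· 1) (n ∸ k) n (m∸n≤m n k)))

HasCoeffs : FPS → (ℕ → ℕ) → Set
HasCoeffs f a = ∀ n → f n ≡ ℤ.+ a n

private
  sumℤ-applyUpTo : ∀ n (F : ℕ → ℤ) (a : ℕ → ℕ) → (∀ k → F k ≡ ℤ.+ a k) → sumℤ (applyUpTo F n) ≡ ℤ.+ ∑< n a
  sumℤ-applyUpTo zero    F a F≡a = refl
  sumℤ-applyUpTo (suc n) F a F≡a = begin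
    F 0 ℤ.+ sumℤ (applyUpTo (F ∘ suc) n) ≡⟨ cong₂ ℤ._+_ (F≡a 0) (sumℤ-applyUpTo n (F ∘ suc) (a ∘ suc) (F≡a ∘ suc)) ⟩
    ℤ.+ a 0 ℤ.+ ℤ.+ ∑< n (a ∘ suc)       ≡⟨ ℤP.pos-+ (a 0) _ ⟨
    ℤ.+ ∑< (suc n) a                     ∎

  sumℤ-map-upTo : ∀ n (F : ℕ → ℤ) (a : ℕ → ℕ) → (∀ k → F k ≡ ℤ.+ a k) → sumℤ (map F (upTo n)) ≡ ℤ.+ ∑< n a
  sumℤ-map-upTo n F a F≡a = trans (cong sumℤ (map-upTo F n)) (sumℤ-applyUpTo n F a F≡a)

  if-[]· : ∀ b → (if b then ℤ.+ 1 else ℤ.+ 0) ≡ ℤ.+ [ b ]· 1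
  if-[]· true  = refl
  if-[]· false = refl

⊛-coeffs : ∀ {f g a b} → HasCoeffs f a → HasCoeffs g b → HasCoeffs (f ⊛ g) (a ∗ b)
⊛-coeffs {a = a} {b} f≡a g≡b n = sumℤ-map-upTo (suc n) _ _
  (λ k → trans (cong₂ ℤ._*_ (f≡a k) (g≡b (n ∸ k))) (sym (ℤP.pos-* (a k) (b (n ∸ k)))))

⊕-coeffs : ∀ {f g a b} → HasCoeffs f a → HasCoeffs g b → HasCoeffs (f ⊕ g) (λ n → a n + b n)
⊕-coeffs {a = a} {b} f≡a g≡b n = trans (cong₂ ℤ._+_ (f≡a n) (g≡b n)) (sym (ℤP.pos-+ (a n) (b n)))

scale-coeffs : ∀ c {f a} → HasCoeffs f a → HasCoeffs (scale (ℤ.+ c) f) (λ n → c * a n)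
scale-coeffs c {a = a} f≡a n = trans (cong (ℤ.+ c ℤ.*_) (f≡a n)) (sym (ℤP.pos-* c (a n)))

mono-coeffs : ∀ a → HasCoeffs (mono a) (monomial a)
mono-coeffs a n = trans (cong (λ b → if b then ℤ.+ 1 else ℤ.+ 0) (isYes≗does (n ≟ a))) (if-[]· (n ≡ᵇ a))

geom-coeffs : ∀ k → HasCoeffs (geom (suc k)) (geometric k)
geom-coeffs k n = trans (cong (λ b → if b then ℤ.+ 1 else ℤ.+ 0) (isYes≗does (n % suc k ≟ 0))) (if-[]· _)

prodL-coeffs : ∀ {A : Set} (F : A → FPS) (a : A → ℕ → ℕ) xs → (∀ x → HasCoeffs (F x) (a x)) →
  HasCoeffs (prodL (map F xs)) (∏ (map a xs))
prodL-coeffs F a []       F≡a zero    = refl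
prodL-coeffs F a []       F≡a (suc n) = refl
prodL-coeffs F a (x ∷ xs) F≡a         = ⊛-coeffs (F≡a x) (prodL-coeffs F a xs F≡a)

infSum-coeffs : ∀ (F : ℕ → FPS) (a : ℕ → ℕ → ℕ) → HasCoeffs (F 0) (λ _ → 0) → (∀ k → HasCoeffs (F (suc k)) (a k)) →
  HasCoeffs (infSum F) (λ n → ∑[ k < n ] a k n)
infSum-coeffs F a F₀ F≡a n = sumℤ-map-upTo (suc n) (λ k → F k n) (a′ n) coeff
  where
  a′ : ℕ → ℕ → ℕ
  a′ n zero    = 0
  a′ n (suc k) = a k n
  coeff : ∀ k → F k n ≡ ℤ.+ a′ n k
  coeff zero    = F₀ n
  coeff (suc k) = F≡a k n

const-zero-coeffs : HasCoeffs (const (ℤ.+ 0)) (λ _ → 0)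
const-zero-coeffs zero    = refl
const-zero-coeffs (suc n) = refl

invPoch-coeffs : ∀ k → HasCoeffs (invPoch k) (λ n → p≤ n k)
invPoch-coeffs k n = begin
  invPoch k n                       ≡⟨ prodL-coeffs (λ i → geom (suc i)) geometric (upTo k) geom-coeffs n ⟩
  ℤ.+ ∏ (map geometric (upTo k)) n  ≡⟨ cong (λ xs → ℤ.+ ∏ (map geometric xs) n) (filter-all P? (universal (λ _ → refl) (upTo k))) ⟨
  ℤ.+ ∏geometric (λ _ → true) k n   ≡⟨ cong ℤ.+_ (∏geometric≡partitionCount (λ _ → true) k n) ⟩
  ℤ.+ p≤ n k                        ∎
  where P? = λ (i : ℕ) → true Bool.≟ true

+-minus : ∀ {a b c} → a ≡ c + b → ℤ.+ a ℤ.- ℤ.+ b ≡ ℤ.+ c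
+-minus {b = b} {c} refl = begin
  ℤ.+ (c + b) ℤ.- ℤ.+ b ≡⟨ ℤP.[+m]-[+n]≡m⊖n (c + b) b ⟩
  (c + b) ℤ.⊖ b         ≡⟨ ℤP.⊖-≥ (m≤n+m b c) ⟩
  ℤ.+ (c + b ∸ b)       ≡⟨ cong ℤ.+_ (m+n∸n≡m c b) ⟩
  ℤ.+ c                 ∎

-- Hooks, row by row

countEq : (ℕ → ℕ) → ℕ → List ℕ → ℕ
countEq f t xs = length (filter (λ j → f j ≟ t) xs)

countEq-∷ : ∀ f t x xs → countEq f t (x ∷ xs) ≡ [ f x ≡ᵇ t ]· 1 + countEq f t xs
countEq-∷ f t x xs with f x ≡ᵇ t
... | true  = refl
... | false = refl

countEq-∷ʳ : ∀ f t xs x → countEq f t (xs ++ x ∷ []) ≡ countEq f t xs + [ f x ≡ᵇ t ]· 1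
countEq-∷ʳ f t []       x = trans (countEq-∷ f t x []) (+-identityʳ _)
countEq-∷ʳ f t (y ∷ xs) x = begin
  countEq f t (y ∷ xs ++ x ∷ [])                         ≡⟨ countEq-∷ f t y _ ⟩
  [ f y ≡ᵇ t ]· 1 + countEq f t (xs ++ x ∷ [])           ≡⟨ cong ([ f y ≡ᵇ t ]· 1 +_) (countEq-∷ʳ f t xs x) ⟩
  [ f y ≡ᵇ t ]· 1 + (countEq f t xs + [ f x ≡ᵇ t ]· 1)   ≡⟨ +-assoc ([ f y ≡ᵇ t ]· 1) _ _ ⟨
  [ f y ≡ᵇ t ]· 1 + countEq f t xs + [ f x ≡ᵇ t ]· 1     ≡⟨ cong (_+ [ f x ≡ᵇ t ]· 1) (countEq-∷ f t y xs) ⟨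
  countEq f t (y ∷ xs) + [ f x ≡ᵇ t ]· 1                 ∎

countEq-cong : ∀ n (h f g : ℕ → ℕ) t → (∀ i → i < n → f (h i) ≡ g (h i)) →
  countEq f t (applyUpTo h n) ≡ countEq g t (applyUpTo h n)
countEq-cong zero    h f g t f≡g = refl
countEq-cong (suc n) h f g t f≡g = begin
  countEq f t (applyUpTo h (suc n))                            ≡⟨ countEq-∷ f t (h 0) _ ⟩
  [ f (h 0) ≡ᵇ t ]· 1 + countEq f t (applyUpTo (h ∘ suc) n)    ≡⟨ cong₂ (λ a b → [ a ≡ᵇ t ]· 1 + b) (f≡g 0 z<s)
                                                                    (countEq-cong n (h ∘ suc) f g t (λ i i<n → f≡g (suc i) (s<s i<n))) ⟩
  [ g (h 0) ≡ᵇ t ]· 1 + countEq g t (applyUpTo (h ∘ suc) n)    ≡⟨ countEq-∷ g t (h 0) _ ⟨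
  countEq g t (applyUpTo h (suc n))                            ∎

countEq-none : ∀ n (h f : ℕ → ℕ) t → (∀ i → i < n → f (h i) ≢ t) → countEq f t (applyUpTo h n) ≡ 0
countEq-none zero    h f t f≢t = refl
countEq-none (suc n) h f t f≢t = begin
  countEq f t (applyUpTo h (suc n))                         ≡⟨ countEq-∷ f t (h 0) _ ⟩
  [ f (h 0) ≡ᵇ t ]· 1 + countEq f t (applyUpTo (h ∘ suc) n) ≡⟨ cong₂ (λ b c → [ b ]· 1 + c) (≡ᵇ-false (f≢t 0 z<s))
                                                                 (countEq-none n (h ∘ suc) f t (λ i i<n → f≢t (suc i) (s<s i<n))) ⟩
  0                                                         ∎

countEq-applyUpTo-suc : ∀ n (h f : ℕ → ℕ) t →
  countEq f t (applyUpTo h (suc n)) ≡ countEq f t (applyUpTo h n) + [ f (h n) ≡ᵇ t ]· 1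
countEq-applyUpTo-suc n h f t =
  trans (cong (countEq f t) (sym (applyUpTo-∷ʳ h n))) (countEq-∷ʳ f t (applyUpTo h n) (h n))

rowHooks : ℕ → List ℕ → ℕ → ℕ → ℕ
rowHooks t λs i y = countEq (λ j → (y + conj λs j + 1) ∸ (i + j)) t (applyUpTo suc y)

hooksFrom : ℕ → List ℕ → ℕ → List ℕ → ℕ
hooksFrom t λs i []       = 0
hooksFrom t λs i (y ∷ ys) = rowHooks t λs i y + hooksFrom t λs (suc i) ys

-- The row sum inside hooksOfLength is a local function that cannot be named; abstracting
-- its arguments with `with` in `expose` lets the meta in the type of `rows` be solved as it.
mutual
  private
    expose : ∀ t x xs → hooksOfLength t (x ∷ xs) ≡ hooksOfLength t (x ∷ xs)
    expose t x xs with x ∷ xs | 2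
    ... | λs | i = cong (rowHooks t (x ∷ xs) 1 x +_) (trans (rows t λs i xs) (sym (rows t λs i xs)))

    rows : ∀ t λs i ys → _ ≡ hooksFrom t λs i ys
    rows t λs i []       = refl
    rows t λs i (y ∷ ys) = cong (rowHooks t λs i y +_) (rows t λs (suc i) ys)

hooksOfLength-rows : ∀ t λs → hooksOfLength t λs ≡ hooksFrom t λs 1 λs
hooksOfLength-rows t []       = refl
hooksOfLength-rows t (x ∷ xs) = cong (rowHooks t (x ∷ xs) 1 x +_) (rows t (x ∷ xs) 2 xs)

Descending : List ℕ → Set
Descending []       = ⊤
Descending (x ∷ xs) = largest xs ≤ x × Descending xs

IsPartition⇒Descending : ∀ {n m} μ → IsPartition n m μ → Descending μ
IsPartition⇒Descending []      _                   = tt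
IsPartition⇒Descending (x ∷ μ) (_ , _ , _ , μ⊢) = largest-≤ μ μ⊢ , IsPartition⇒Descending μ μ⊢

conj-≤ : ∀ x xs j → j ≤ x → conj (x ∷ xs) j ≡ suc (conj xs j)
conj-≤ x xs j j≤x rewrite ≤ᵇ-true j≤x = refl

conj-> : ∀ x xs j → x < j → conj (x ∷ xs) j ≡ conj xs j
conj-> x xs j x<j rewrite ≤ᵇ-false x<j = refl

conj-beyond : ∀ xs j → Descending xs → largest xs < j → conj xs j ≡ 0
conj-beyond []       j _                  _          = refl
conj-beyond (x ∷ xs) j (xs≤x , xs↓) x<j = trans (conj-> x xs j x<j) (conj-beyond xs j xs↓ (≤-<-trans xs≤x x<j))

topRowHooks : ℕ → ℕ → List ℕ → ℕ
topRowHooks t y ys = rowHooks t (y ∷ ys) 1 y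

sumTopRowHooks : ℕ → List ℕ → ℕ
sumTopRowHooks t []       = 0
sumTopRowHooks t (y ∷ ys) = topRowHooks t y ys + sumTopRowHooks t ys

-- Each of the k rows above row y adds one to the column heights over y and one to its
-- row index; the two cancel in the hook lengths.
hooksOfLength-topRows : ∀ t λs → Descending λs → hooksOfLength t λs ≡ sumTopRowHooks t λs
hooksOfLength-topRows t λs λs↓ = trans (hooksOfLength-rows t λs) (below λs λs 0 λs↓ (λ _ _ → refl))
  where
  shift-row : ∀ L k y ys → (∀ j → j ≤ y → conj L j ≡ k + conj (y ∷ ys) j) → rowHooks t L (suc k) y ≡ topRowHooks t y ys
  shift-row L k y ys conj≡ = countEq-cong y suc _ _ t (λ i i<y → hook≡ (suc i) i<y)
    where
    hook≡ : ∀ j → j ≤ y → (y + conj L j + 1) ∸ (suc k + j) ≡ (y + conj (y ∷ ys) j + 1) ∸ (1 + j)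
    hook≡ j j≤y = begin
      (y + conj L j + 1) ∸ (suc k + j)       ≡⟨ cong (λ c → (y + c + 1) ∸ (suc k + j)) (conj≡ j j≤y) ⟩
      (y + (k + c) + 1) ∸ (suc k + j)        ≡⟨ cong₂ _∸_ (solve 3 (λ y k c → y :+ (k :+ c) :+ con 1 := k :+ (y :+ c :+ con 1)) refl y k c)
                                                           (sym (+-suc k j)) ⟩
      (k + (y + c + 1)) ∸ (k + (1 + j))      ≡⟨ [m+n]∸[m+o]≡n∸o k _ _ ⟩
      (y + c + 1) ∸ (1 + j)                  ∎
      where c = conj (y ∷ ys) j

  below : ∀ L ys k → Descending ys → (∀ j → j ≤ largest ys → conj L j ≡ k + conj ys j) →
    hooksFrom t L (suc k) ys ≡ sumTopRowHooks t ys
  below L []       k _               _      = refl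
  below L (y ∷ ys) k (ys≤y , ys↓) conj≡ = cong₂ _+_ (shift-row L k y ys conj≡) (below L ys (suc k) ys↓ conj≡′)
    where
    conj≡′ : ∀ j → j ≤ largest ys → conj L j ≡ suc k + conj ys j
    conj≡′ j j≤ys = trans (conj≡ j (≤-trans j≤ys ys≤y)) (trans (cong (k +_) (conj-≤ y ys j (≤-trans j≤ys ys≤y))) (+-suc k _))

-- A 2-hook of the top row is its last cell with exactly one cell below it, or its
-- second-to-last cell with no cell below it.
topRowHooks-2 : ∀ y ys → 1 ≤ y →
  topRowHooks 2 y ys ≡ [ conj ys y ≡ᵇ 1 ]· 1 + [ 2 ≤ᵇ y ]· [ conj ys (y ∸ 1) ≡ᵇ 0 ]· 1
topRowHooks-2 y ys 1≤y = trans (countEq-cong y suc _ (hook y) 2 (λ i i<y → hook≡ (suc i) i<y)) (count y 1≤y)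
  where
  hook : ℕ → ℕ → ℕ
  hook y j = (y ∸ j) + suc (conj ys j)

  hook≡ : ∀ j → j ≤ y → (y + conj (y ∷ ys) j + 1) ∸ (1 + j) ≡ hook y j
  hook≡ j j≤y = begin
    (y + conj (y ∷ ys) j + 1) ∸ (1 + j)        ≡⟨ cong (λ c → (y + c + 1) ∸ (1 + j)) (conj-≤ y ys j j≤y) ⟩
    (y + suc c + 1) ∸ (1 + j)                  ≡⟨ cong (λ y′ → (y′ + suc c + 1) ∸ (1 + j)) (m∸n+n≡m j≤y) ⟨
    ((y ∸ j) + j + suc c + 1) ∸ (1 + j)        ≡⟨ cong (_∸ (1 + j))
                                                    (solve 3 (λ d j c → d :+ j :+ (con 1 :+ c) :+ con 1 := d :+ (con 1 :+ c) :+ (con 1 :+ j)) refl (y ∸ j) j c) ⟩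
    ((y ∸ j) + suc c + (1 + j)) ∸ (1 + j)      ≡⟨ m+n∸n≡m _ (1 + j) ⟩
    (y ∸ j) + suc c                            ∎
    where c = conj ys j

  long-arm : ∀ k i → i < k → 2 ≤ suc k ∸ i
  long-arm (suc k) zero    _         = s≤s (s≤s z≤n)
  long-arm (suc k) (suc i) (s≤s i<k) = long-arm k i i<k

  count : ∀ y → 1 ≤ y → countEq (hook y) 2 (applyUpTo suc y) ≡ [ conj ys y ≡ᵇ 1 ]· 1 + [ 2 ≤ᵇ y ]· [ conj ys (y ∸ 1) ≡ᵇ 0 ]· 1
  count (suc zero)    _ = countEq-∷ (hook 1) 2 1 []
  count (suc (suc k)) _ = begin
    countEq (hook y′) 2 (applyUpTo suc (suc (suc k)))
      ≡⟨ countEq-applyUpTo-suc (suc k) suc (hook y′) 2 ⟩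
    countEq (hook y′) 2 (applyUpTo suc (suc k)) + [ hook y′ y′ ≡ᵇ 2 ]· 1
      ≡⟨ cong (_+ [ hook y′ y′ ≡ᵇ 2 ]· 1) (countEq-applyUpTo-suc k suc (hook y′) 2) ⟩
    countEq (hook y′) 2 (applyUpTo suc k) + [ hook y′ (suc k) ≡ᵇ 2 ]· 1 + [ hook y′ y′ ≡ᵇ 2 ]· 1
      ≡⟨ cong₂ (λ a b → a + [ b + suc (conj ys (suc k)) ≡ᵇ 2 ]· 1 + [ hook y′ y′ ≡ᵇ 2 ]· 1)
           (countEq-none k suc (hook y′) 2 λ i i<k eq → <⇒≢ (+-mono-≤ (long-arm k i i<k) (s≤s (z≤n {conj ys (suc i)}))) (sym eq))
           (m+n∸n≡m 1 k) ⟩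
    [ conj ys (suc k) ≡ᵇ 0 ]· 1 + [ hook y′ y′ ≡ᵇ 2 ]· 1
      ≡⟨ cong (λ d → [ conj ys (suc k) ≡ᵇ 0 ]· 1 + [ d + suc (conj ys y′) ≡ᵇ 2 ]· 1) (n∸n≡0 y′) ⟩
    [ conj ys (suc k) ≡ᵇ 0 ]· 1 + [ conj ys y′ ≡ᵇ 1 ]· 1
      ≡⟨ +-comm ([ conj ys (suc k) ≡ᵇ 0 ]· 1) _ ⟩
    [ conj ys y′ ≡ᵇ 1 ]· 1 + [ conj ys (suc k) ≡ᵇ 0 ]· 1 ∎
    where y′ = suc (suc k)

topRowHooks-2-gap : ∀ y z zs → 1 ≤ y → Descending (z ∷ zs) → z + 2 ≤ y → topRowHooks 2 y (z ∷ zs) ≡ [ 2 ≤ᵇ y ]· 1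
topRowHooks-2-gap y z zs 1≤y zs↓ z+2≤y = begin
  topRowHooks 2 y (z ∷ zs)                                                ≡⟨ topRowHooks-2 y (z ∷ zs) 1≤y ⟩
  [ conj (z ∷ zs) y ≡ᵇ 1 ]· 1 + [ 2 ≤ᵇ y ]· [ conj (z ∷ zs) (y ∸ 1) ≡ᵇ 0 ]· 1
    ≡⟨ cong₂ (λ a b → [ a ≡ᵇ 1 ]· 1 + [ 2 ≤ᵇ y ]· [ b ≡ᵇ 0 ]· 1)
         (conj-beyond (z ∷ zs) y zs↓ (≤-trans gap-below (m∸n≤m y 1))) (conj-beyond (z ∷ zs) (y ∸ 1) zs↓ gap-below) ⟩
  [ 2 ≤ᵇ y ]· 1                                                           ∎
  where
  gap-below : z < y ∸ 1
  gap-below = ∸-monoˡ-≤ 1 (subst (_≤ y) (+-comm z 2) z+2≤y)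

r-partSum : ∀ P n → r P n ≡ partSum (λ μ → [ P μ ]· hooksOfLength 2 μ) n n
r-partSum P n = sum-filter (partitions n)
  where
  sum-filter : ∀ μs → sumℕ (map (hooksOfLength 2) (filter (λ μ → P μ Bool.≟ true) μs)) ≡ sum (map (λ μ → [ P μ ]· hooksOfLength 2 μ) μs)
  sum-filter []       = refl
  sum-filter (μ ∷ μs) with P μ
  ... | true  = cong (hooksOfLength 2 μ +_) (sum-filter μs)
  ... | false = sum-filter μs

-- Parts congruent to 1 or 4 modulo 5

is14-+5 : ∀ x → is14 (5 + x) ≡ is14 x
is14-+5 x = cong (λ r → ⌊ r ≟ 1 ⌋ ∨ ⌊ r ≟ 4 ⌋) (trans (cong (_% 5) (+-comm 5 x)) ([m+n]%n≡m%n x 5))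

is14-consecutive : ∀ x → is14 x ≡ true → is14 (suc x) ≡ false
is14-consecutive 0 ()
is14-consecutive 1 _ = refl
is14-consecutive 2 ()
is14-consecutive 3 ()
is14-consecutive 4 _ = refl
is14-consecutive (suc (suc (suc (suc (suc x))))) x∈ =
  trans (is14-+5 (suc x)) (is14-consecutive x (trans (sym (is14-+5 x)) x∈))

is14-gap : ∀ {a b} → is14 a ≡ true → is14 b ≡ true → b < a → b + 2 ≤ a
is14-gap {a} {b} a∈ b∈ (s≤s b≤a′) with m≤n⇒m<n∨m≡n b≤a′
... | inj₁ b<a′ = ≤-trans (≤-reflexive (+-comm b 2)) (s≤s b<a′)
... | inj₂ refl = case trans (sym a∈) (is14-consecutive b b∈) of λ ()

parts14mod5-allParts : ∀ μ → parts14mod5 μ ≡ allParts is14 μ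
parts14mod5-allParts []       = refl
parts14mod5-allParts (x ∷ μ) = cong (is14 x ∧_) (parts14mod5-allParts μ)

allowedRowHooks : ℕ → List ℕ → ℕ
allowedRowHooks y []       = [ 2 ≤ᵇ y ]· 1
allowedRowHooks y (z ∷ zs) = if z ≡ᵇ y then (if largest zs ≡ᵇ y then 0 else 1) else 1

sumAllowedRowHooks : List ℕ → ℕ
sumAllowedRowHooks []       = 0
sumAllowedRowHooks (y ∷ ys) = allowedRowHooks y ys + sumAllowedRowHooks ys

topRowHooks-2-allowed : ∀ y z zs → 1 ≤ y → Descending (y ∷ z ∷ zs) → is14 y ≡ true → is14 z ≡ true →
  topRowHooks 2 y (z ∷ zs) ≡ allowedRowHooks y (z ∷ zs)
topRowHooks-2-allowed y z zs 1≤y (z≤y , zs≤z , zs↓) y∈ z∈ with z ≡ᵇ y in z≡ᵇy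
... | true  with refl ← ≡ᵇ-sound {z} {y} z≡ᵇy = begin
  topRowHooks 2 z (z ∷ zs)                                                  ≡⟨ topRowHooks-2 z (z ∷ zs) 1≤y ⟩
  [ conj (z ∷ zs) z ≡ᵇ 1 ]· 1 + [ 2 ≤ᵇ z ]· [ conj (z ∷ zs) (z ∸ 1) ≡ᵇ 0 ]· 1
    ≡⟨ cong₂ (λ a b → [ a ≡ᵇ 1 ]· 1 + [ 2 ≤ᵇ z ]· [ b ≡ᵇ 0 ]· 1) (conj-≤ z zs z ≤-refl) (conj-≤ z zs (z ∸ 1) (m∸n≤m z 1)) ⟩
  [ conj zs z ≡ᵇ 0 ]· 1 + [ 2 ≤ᵇ z ]· 0                                     ≡⟨ cong ([ conj zs z ≡ᵇ 0 ]· 1 +_) ([]·-zero (2 ≤ᵇ z)) ⟩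
  [ conj zs z ≡ᵇ 0 ]· 1 + 0                                                 ≡⟨ +-identityʳ _ ⟩
  [ conj zs z ≡ᵇ 0 ]· 1                                                     ≡⟨ below zs zs≤z zs↓ ⟩
  (if largest zs ≡ᵇ z then 0 else 1)                                        ∎
  where
  below : ∀ zs → largest zs ≤ z → Descending zs → [ conj zs z ≡ᵇ 0 ]· 1 ≡ (if largest zs ≡ᵇ z then 0 else 1)
  below []       _    _  = cong (λ b → if b then 0 else 1) (sym (≡ᵇ-false (<⇒≢ 1≤y)))
  below (u ∷ us) u≤z us↓ with u ≡ᵇ z in u≡ᵇz
  ... | true  = cong (λ c → [ c ≡ᵇ 0 ]· 1) (conj-≤ u us z (≤-reflexive (sym (≡ᵇ-sound u≡ᵇz))))
  ... | false = cong (λ c → [ c ≡ᵇ 0 ]· 1)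
                  (conj-beyond (u ∷ us) z us↓ (≤∧≢⇒< u≤z (λ u≡z → case trans (sym u≡ᵇz) (≡ᵇ-true u≡z) of λ ())))
... | false = begin
  topRowHooks 2 y (z ∷ zs) ≡⟨ topRowHooks-2-gap y z zs 1≤y (zs≤z , zs↓) z+2≤y ⟩
  [ 2 ≤ᵇ y ]· 1            ≡⟨ cong ([_]· 1) (≤ᵇ-true (≤-trans (m≤n+m 2 z) z+2≤y)) ⟩
  1                        ∎
  where
  z+2≤y : z + 2 ≤ y
  z+2≤y = is14-gap y∈ z∈ (≤∧≢⇒< z≤y (λ z≡y → case trans (sym z≡ᵇy) (≡ᵇ-true z≡y) of λ ()))

sumTopRowHooks-allowed : ∀ {n m} λs → IsPartition n m λs → allParts is14 λs ≡ true →
  sumTopRowHooks 2 λs ≡ sumAllowedRowHooks λs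
sumTopRowHooks-allowed []               _                  _  = refl
sumTopRowHooks-allowed (y ∷ [])         (1≤y , _)          _  = cong (_+ 0) (topRowHooks-2 y [] 1≤y)
sumTopRowHooks-allowed (y ∷ z ∷ zs) λ⊢@(1≤y , _ , _ , μ⊢) λ∈ =
  cong₂ _+_ (topRowHooks-2-allowed y z zs 1≤y (IsPartition⇒Descending (y ∷ z ∷ zs) λ⊢) y∈ z∈)
            (sumTopRowHooks-allowed (z ∷ zs) μ⊢ μ∈)
  where
  y∈ = proj₁ (∧-true {is14 y} λ∈)
  μ∈ = proj₂ (∧-true {is14 y} λ∈)
  z∈ = proj₁ (∧-true {is14 z} μ∈)

allowedCount : ℕ → ℕ → ℕ
allowedCount = partitionCount is14

allowedCount-rec : PartitionRecursion is14 allowedCount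
allowedCount-rec = partitionCount-largest is14

allowedHooks : ℕ → ℕ → ℕ
allowedHooks = partSum (λ μ → [ allParts is14 μ ]· sumAllowedRowHooks μ)

newRowHooks : ℕ → ℕ → ℕ
newRowHooks n v = partSum (λ μ → [ allParts is14 μ ]· allowedRowHooks v μ) n v

allowedHooks-largest : ∀ n m → allowedHooks n (suc m) ≡
  allowedHooks n m + [ suc m ≤ᵇ n ]· [ is14 (suc m) ]· (allowedHooks (n ∸ suc m) (suc m) + newRowHooks (n ∸ suc m) (suc m))
allowedHooks-largest n m = trans (partSum-largest w n m) (cong (λ x → allowedHooks n m + [ suc m ≤ᵇ n ]· x) (begin
  partSum (λ μ → [ is14 v ∧ allParts is14 μ ]· (allowedRowHooks v μ + sumAllowedRowHooks μ)) N v
    ≡⟨ partSum-cong N v (λ μ _ → split (is14 v) (allParts is14 μ) (allowedRowHooks v μ) (sumAllowedRowHooks μ)) ⟩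
  partSum (λ μ → [ is14 v ]· ([ allParts is14 μ ]· allowedRowHooks v μ + w μ)) N v
    ≡⟨ partSum-[]· (is14 v) (λ μ → [ allParts is14 μ ]· allowedRowHooks v μ + w μ) N v ⟩
  [ is14 v ]· partSum (λ μ → [ allParts is14 μ ]· allowedRowHooks v μ + w μ) N v
    ≡⟨ cong ([ is14 v ]·_) (partSum-+ (λ μ → [ allParts is14 μ ]· allowedRowHooks v μ) w N v) ⟩
  [ is14 v ]· (newRowHooks N v + allowedHooks N v)
    ≡⟨ cong ([ is14 v ]·_) (+-comm (newRowHooks N v) _) ⟩
  [ is14 v ]· (allowedHooks N v + newRowHooks N v) ∎))
  where
  v = suc m
  N = n ∸ suc m
  w = λ μ → [ allParts is14 μ ]· sumAllowedRowHooks μ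
  split : ∀ b c x y → [ b ∧ c ]· (x + y) ≡ [ b ]· ([ c ]· x + [ c ]· y)
  split true  c x y = []·-distrib-+ c x y
  split false c x y = refl

-- Below a new top row v the next part is either smaller (then, being allowed, at most v - 2)
-- or equal to v; in the second case the 2-hook survives unless v occurs a third time.
newRowHooks-allowed : ∀ n k → is14 (suc k) ≡ true →
  newRowHooks n (suc k) ≡ [ 2 ≤ᵇ suc k ]· allowedCount n k + [ suc k ≤ᵇ n ]· allowedCount (n ∸ suc k) k
newRowHooks-allowed n k v∈ = trans (partSum-largest row n k) (cong₂ _+_ next-smaller (cong ([ suc k ≤ᵇ n ]·_) next-equal))
  where
  v = suc k
  row = λ μ → [ allParts is14 μ ]· allowedRowHooks v μ

  next-smaller : partSum row n k ≡ [ 2 ≤ᵇ v ]· allowedCount n k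
  next-smaller = trans (partSum-cong n k row≡) (partSum-[]· (2 ≤ᵇ v) (λ μ → [ allParts is14 μ ]· 1) n k)
    where
    row≡ : ∀ μ → IsPartition n k μ → row μ ≡ [ 2 ≤ᵇ v ]· [ allParts is14 μ ]· 1
    row≡ []       _ = refl
    row≡ (z ∷ zs) (_ , z≤k , _) with allParts is14 (z ∷ zs) in μ∈
    ... | false = sym ([]·-zero (2 ≤ᵇ v))
    ... | true rewrite ≡ᵇ-false {z} {v} (<⇒≢ (s≤s z≤k))
                     | ≤ᵇ-true {2} {v} (≤-trans (m≤n+m 2 z) (is14-gap v∈ (proj₁ (∧-true {is14 z} μ∈)) (s≤s z≤k))) = refl

  next-equal : partSum (row ∘ (v ∷_)) (n ∸ v) v ≡ allowedCount (n ∸ v) k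
  next-equal = trans (partSum-restrict (row ∘ (v ∷_)) (n ∸ v) k v (n≤1+n k) thrice) (partSum-cong (n ∸ v) k twice)
    where
    thrice : ∀ μ → IsPartition (n ∸ v) v μ → k < largest μ → row (v ∷ μ) ≡ 0
    thrice μ μ⊢ k<μ rewrite v∈ | ≡ᵇ-true (refl {x = v}) | ≡ᵇ-true (≤-antisym (largest-≤ μ μ⊢) k<μ) = []·-zero (allParts is14 μ)
    twice : ∀ μ → IsPartition (n ∸ v) k μ → row (v ∷ μ) ≡ [ allParts is14 μ ]· 1
    twice μ μ⊢ rewrite v∈ | ≡ᵇ-true (refl {x = v}) | ≡ᵇ-false {largest μ} {v} (<⇒≢ (s≤s (largest-≤ μ μ⊢))) = refl

-- Over the allowed partitions of n with parts at most m: a 2-hook for each one containing the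
-- part v, if v ≥ 2, and another for each one containing v at least twice.
hooksOfPart : ℕ → ℕ → ℕ → ℕ
hooksOfPart v n m = [ is14 v ]· ([ 2 ≤ᵇ v ]· [ v ≤ᵇ n ]· allowedCount (n ∸ v) m + [ v + v ≤ᵇ n ]· allowedCount (n ∸ (v + v)) m)

hooksOfPart-rec : ∀ v → PartitionRecursion is14 (hooksOfPart v)
hooksOfPart-rec v = partitionRecursion-[]· is14 (is14 v) {λ n m → [ 2 ≤ᵇ v ]· once n m + twice n m}
  (partitionRecursion-+ is14 {λ n m → [ 2 ≤ᵇ v ]· once n m} {twice}
    (partitionRecursion-[]· is14 (2 ≤ᵇ v) {once} (partitionRecursion-shift is14 v {allowedCount} allowedCount-rec))
    (partitionRecursion-shift is14 (v + v) {allowedCount} allowedCount-rec))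
  where
  once twice : ℕ → ℕ → ℕ
  once  n m = [ v ≤ᵇ n ]· allowedCount (n ∸ v) m
  twice n m = [ v + v ≤ᵇ n ]· allowedCount (n ∸ (v + v)) m

hooksOfParts : ℕ → ℕ → ℕ
hooksOfParts n m = ∑[ i < m ] hooksOfPart (suc i) n m

hooksStep : ℕ → ℕ → ℕ → ℕ → ℕ
hooksStep n m x y = x + [ is14 (suc m) ]· y + hooksOfPart (suc m) n m

hooksOfParts-rec : LargestPartRecursion hooksStep hooksOfParts
hooksOfParts-rec n m = begin
  ∑[ i < suc m ] hooksOfPart (suc i) n (suc m)
    ≡⟨ ∑-cong (suc m) (λ i _ → hooksOfPart-rec (suc i) n m) ⟩
  ∑[ i < suc m ] (hooksOfPart (suc i) n m + [ s ]· [ g ]· hooksOfPart (suc i) (n ∸ suc m) (suc m))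
    ≡⟨ ∑-+ (suc m) (λ i → hooksOfPart (suc i) n m) (λ i → [ s ]· [ g ]· new i) ⟩
  ∑[ i < suc m ] hooksOfPart (suc i) n m + ∑[ i < suc m ] ([ s ]· [ g ]· new i)
    ≡⟨ cong₂ _+_ (∑-suc m (λ i → hooksOfPart (suc i) n m))
                 (trans (sym (∑-[]· s (suc m) (λ i → [ g ]· new i))) (cong ([ s ]·_) (sym (∑-[]· g (suc m) new)))) ⟩
  hooksOfParts n m + hooksOfPart (suc m) n m + [ s ]· [ g ]· hooksOfParts (n ∸ suc m) (suc m)
    ≡⟨ +-assoc (hooksOfParts n m) _ _ ⟩
  hooksOfParts n m + (hooksOfPart (suc m) n m + [ s ]· [ g ]· hooksOfParts (n ∸ suc m) (suc m))
    ≡⟨ cong (hooksOfParts n m +_) (+-comm (hooksOfPart (suc m) n m) _) ⟩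
  hooksOfParts n m + ([ s ]· [ g ]· hooksOfParts (n ∸ suc m) (suc m) + hooksOfPart (suc m) n m)
    ≡⟨ +-assoc (hooksOfParts n m) _ _ ⟨
  hooksOfParts n m + [ s ]· [ g ]· hooksOfParts (n ∸ suc m) (suc m) + hooksOfPart (suc m) n m ∎
  where
  s = is14 (suc m)
  g = suc m ≤ᵇ n
  new = λ i → hooksOfPart (suc i) (n ∸ suc m) (suc m)

newRowHooks-hooksOfPart : ∀ n m →
  [ suc m ≤ᵇ n ]· [ is14 (suc m) ]· newRowHooks (n ∸ suc m) (suc m) ≡ hooksOfPart (suc m) n m
newRowHooks-hooksOfPart n m with is14 (suc m) in v∈
... | false = []·-zero (suc m ≤ᵇ n)
... | true  = begin
  [ v ≤ᵇ n ]· newRowHooks (n ∸ v) v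
    ≡⟨ cong ([ v ≤ᵇ n ]·_) (newRowHooks-allowed (n ∸ v) m v∈) ⟩
  [ v ≤ᵇ n ]· ([ 2 ≤ᵇ v ]· allowedCount (n ∸ v) m + [ v ≤ᵇ n ∸ v ]· allowedCount (n ∸ v ∸ v) m)
    ≡⟨ []·-distrib-+ (v ≤ᵇ n) _ _ ⟩
  [ v ≤ᵇ n ]· [ 2 ≤ᵇ v ]· allowedCount (n ∸ v) m + [ v ≤ᵇ n ]· [ v ≤ᵇ n ∸ v ]· allowedCount (n ∸ v ∸ v) m
    ≡⟨ cong₂ _+_ ([]·-comm (2 ≤ᵇ v) (v ≤ᵇ n) (allowedCount (n ∸ v) m)) ([]·-shift-+ v v n (λ k → allowedCount k m)) ⟨
  [ 2 ≤ᵇ v ]· [ v ≤ᵇ n ]· allowedCount (n ∸ v) m + [ v + v ≤ᵇ n ]· allowedCount (n ∸ (v + v)) m ∎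
  where v = suc m

allowedHooks-rec : LargestPartRecursion hooksStep allowedHooks
allowedHooks-rec n m = begin
  allowedHooks n (suc m)                                         ≡⟨ allowedHooks-largest n m ⟩
  allowedHooks n m + [ g ]· [ s ]· (H′ + R′)                     ≡⟨ cong (allowedHooks n m +_)
                                                                      (trans (cong ([ g ]·_) ([]·-distrib-+ s H′ R′)) ([]·-distrib-+ g _ _)) ⟩
  allowedHooks n m + ([ g ]· [ s ]· H′ + [ g ]· [ s ]· R′)       ≡⟨ cong₂ (λ a b → allowedHooks n m + (a + b))
                                                                      ([]·-comm g s H′) (newRowHooks-hooksOfPart n m) ⟩
  allowedHooks n m + ([ s ]· [ g ]· H′ + hooksOfPart (suc m) n m) ≡⟨ +-assoc (allowedHooks n m) _ _ ⟨
  allowedHooks n m + [ s ]· [ g ]· H′ + hooksOfPart (suc m) n m  ∎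
  where
  s = is14 (suc m)
  g = suc m ≤ᵇ n
  H′ = allowedHooks (n ∸ suc m) (suc m)
  R′ = newRowHooks (n ∸ suc m) (suc m)

allowedHooks≡hooksOfParts : ∀ n m → allowedHooks n m ≡ hooksOfParts n m
allowedHooks≡hooksOfParts = largestPartRecursion-unique hooksStep {allowedHooks} {hooksOfParts} noParts allowedHooks-rec hooksOfParts-rec
  where
  noParts : ∀ n → allowedHooks n 0 ≡ 0
  noParts zero    = refl
  noParts (suc n) = partSum-noParts (λ μ → [ allParts is14 μ ]· sumAllowedRowHooks μ) n

-- The series (q^4 + q^6)/(1 - q^5) and (q^2 + q^8)/(1 - q^10)

geometric-period : ∀ k x → geometric k (suc k + x) ≡ geometric k x
geometric-period k x = cong (λ r → [ r ≡ᵇ 0 ]· 1) (trans (cong (_% suc k) (+-comm (suc k) x)) ([m+n]%n≡m%n x (suc k)))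

τ₁ : ℕ → ℕ
τ₁ j = [ 4 ≤ᵇ j ]· geometric 4 (j ∸ 4) + [ 6 ≤ᵇ j ]· geometric 4 (j ∸ 6)

τ₁-allowed : ∀ j → τ₁ j ≡ [ is14 j ]· [ 2 ≤ᵇ j ]· 1
τ₁-allowed 0  = refl
τ₁-allowed 1  = refl
τ₁-allowed 2  = refl
τ₁-allowed 3  = refl
τ₁-allowed 4  = refl
τ₁-allowed 5  = refl
τ₁-allowed 6  = refl
τ₁-allowed 7  = refl
τ₁-allowed 8  = refl
τ₁-allowed 9  = refl
τ₁-allowed 10 = refl
τ₁-allowed (suc (suc (suc (suc (suc (suc (suc (suc (suc (suc (suc j))))))))))) = begin
  τ₁ (5 + (6 + j))          ≡⟨ cong₂ _+_ (geometric-period 4 (2 + j)) (geometric-period 4 j) ⟩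
  τ₁ (6 + j)                ≡⟨ τ₁-allowed (suc (suc (suc (suc (suc (suc j)))))) ⟩
  [ is14 (6 + j) ]· 1       ≡⟨ cong ([_]· 1) (is14-+5 (6 + j)) ⟨
  [ is14 (11 + j) ]· 1      ∎

τ₂ : ℕ → ℕ
τ₂ j = [ 2 ≤ᵇ j ]· geometric 9 (j ∸ 2) + [ 8 ≤ᵇ j ]· geometric 9 (j ∸ 8)

τ₂-period : ∀ y → τ₂ (10 + (8 + y)) ≡ τ₂ (8 + y)
τ₂-period y = cong₂ _+_ (geometric-period 9 (6 + y)) (geometric-period 9 y)

τ₂-even : ∀ v → τ₂ (v + v) ≡ [ is14 v ]· 1
τ₂-even 0 = refl
τ₂-even 1 = refl
τ₂-even 2 = refl
τ₂-even 3 = refl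
τ₂-even 4 = refl
τ₂-even 5 = refl
τ₂-even 6 = refl
τ₂-even 7 = refl
τ₂-even 8 = refl
τ₂-even (suc (suc (suc (suc (suc (suc (suc (suc (suc w))))))))) = begin
  τ₂ ((9 + w) + (9 + w))     ≡⟨ cong τ₂ (solve 1 (λ w → (con 9 :+ w) :+ (con 9 :+ w) := con 10 :+ (con 8 :+ (w :+ w))) refl w) ⟩
  τ₂ (10 + (8 + (w + w)))    ≡⟨ τ₂-period (w + w) ⟩
  τ₂ (8 + (w + w))           ≡⟨ cong τ₂ (solve 1 (λ w → con 8 :+ (w :+ w) := (con 4 :+ w) :+ (con 4 :+ w)) refl w) ⟩
  τ₂ ((4 + w) + (4 + w))     ≡⟨ τ₂-even (suc (suc (suc (suc w)))) ⟩
  [ is14 (4 + w) ]· 1        ≡⟨ cong ([_]· 1) (is14-+5 (4 + w)) ⟨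
  [ is14 (9 + w) ]· 1        ∎

τ₂-odd : ∀ v → τ₂ (suc (v + v)) ≡ 0
τ₂-odd 0 = refl
τ₂-odd 1 = refl
τ₂-odd 2 = refl
τ₂-odd 3 = refl
τ₂-odd 4 = refl
τ₂-odd 5 = refl
τ₂-odd 6 = refl
τ₂-odd 7 = refl
τ₂-odd 8 = refl
τ₂-odd (suc (suc (suc (suc (suc (suc (suc (suc (suc w))))))))) = begin
  τ₂ (suc ((9 + w) + (9 + w)))  ≡⟨ cong τ₂ (solve 1 (λ w → con 1 :+ ((con 9 :+ w) :+ (con 9 :+ w))
                                                        := con 10 :+ (con 8 :+ (con 1 :+ (w :+ w)))) refl w) ⟩
  τ₂ (10 + (8 + suc (w + w)))   ≡⟨ τ₂-period (suc (w + w)) ⟩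
  τ₂ (8 + suc (w + w))          ≡⟨ cong τ₂ (solve 1 (λ w → con 8 :+ (con 1 :+ (w :+ w)) := con 1 :+ ((con 4 :+ w) :+ (con 4 :+ w))) refl w) ⟩
  τ₂ (suc ((4 + w) + (4 + w)))  ≡⟨ τ₂-odd (suc (suc (suc (suc w)))) ⟩
  0                             ∎

private
  even-or-odd : ∀ j → Σ[ v ∈ ℕ ] (j ≡ v + v ⊎ j ≡ suc (v + v))
  even-or-odd zero = 0 , inj₁ refl
  even-or-odd (suc j) with even-or-odd j
  ... | v , inj₁ j≡ = v , inj₂ (cong suc j≡)
  ... | v , inj₂ j≡ = suc v , inj₁ (cong suc (trans j≡ (sym (+-suc v v))))

  double-≡ᵇ : ∀ a b → (a + a ≡ᵇ b + b) ≡ (a ≡ᵇ b)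
  double-≡ᵇ zero    zero    = refl
  double-≡ᵇ zero    (suc b) = refl
  double-≡ᵇ (suc a) zero    = refl
  double-≡ᵇ (suc a) (suc b) rewrite +-suc a a | +-suc b b = double-≡ᵇ a b

  odd-≡ᵇ-even : ∀ a b → (suc (a + a) ≡ᵇ b + b) ≡ false
  odd-≡ᵇ-even zero    zero          = refl
  odd-≡ᵇ-even zero    (suc zero)    = refl
  odd-≡ᵇ-even zero    (suc (suc b)) = refl
  odd-≡ᵇ-even (suc a) zero          = refl
  odd-≡ᵇ-even (suc a) (suc b) rewrite +-suc a a | +-suc b b = odd-≡ᵇ-even a b

τ₂-doubles : ∀ n j → j ≤ n → τ₂ j ≡ ∑[ i < n ] ([ j ≡ᵇ suc i + suc i ]· [ is14 (suc i) ]· 1)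
τ₂-doubles n j j≤n with even-or-odd j
... | zero  , inj₁ refl = sym (∑-zero n (λ _ _ → refl))
... | suc w , inj₁ refl = begin
  τ₂ (suc w + suc w)                                 ≡⟨ τ₂-even (suc w) ⟩
  [ is14 (suc w) ]· 1                                ≡⟨ cong (λ b → [ b ]· [ is14 (suc w) ]· 1) (≤ᵇ-true (≤-trans (m≤m+n (suc w) (suc w)) j≤n)) ⟨
  [ suc w ≤ᵇ n ]· [ is14 (suc w) ]· 1                ≡⟨ ∑-indicator n w (λ i → [ is14 (suc i) ]· 1) ⟨
  ∑[ i < n ] ([ i ≡ᵇ w ]· [ is14 (suc i) ]· 1)       ≡⟨ ∑-cong n (λ i _ → cong (λ b → [ b ]· [ is14 (suc i) ]· 1)
                                                          (trans (≡ᵇ-sym i w) (sym (double-≡ᵇ (suc w) (suc i))))) ⟩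
  ∑[ i < n ] ([ suc w + suc w ≡ᵇ suc i + suc i ]· [ is14 (suc i) ]· 1) ∎
... | v , inj₂ refl = trans (τ₂-odd v) (sym (∑-zero n (λ i _ → cong (λ b → [ b ]· [ is14 (suc i) ]· 1) (odd-≡ᵇ-even v (suc i)))))

τ₁-∗ : ∀ P n → (τ₁ ∗ P) n ≡ ∑[ i < n ] ([ is14 (suc i) ]· [ 2 ≤ᵇ suc i ]· P (n ∸ suc i))
τ₁-∗ P n = ∑-cong (suc n) λ j _ →
  trans (cong (_* P (n ∸ j)) (τ₁-allowed j)) (trans ([]·-*-assoc (is14 j) _ _) (cong ([ is14 j ]·_) ([]·1-* (2 ≤ᵇ j) _)))

τ₂-∗ : ∀ P n → (τ₂ ∗ P) n ≡ ∑[ i < n ] ([ is14 (suc i) ]· [ suc i + suc i ≤ᵇ n ]· P (n ∸ (suc i + suc i)))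
τ₂-∗ P n = begin
  ∑[ j < suc n ] (τ₂ j * P (n ∸ j))
    ≡⟨ ∑-cong (suc n) (λ j j≤n → trans (cong (_* P (n ∸ j)) (τ₂-doubles n j (≤-pred j≤n))) (sym (∑-*ʳ n (P (n ∸ j)) _))) ⟩
  ∑[ j < suc n ] ∑[ i < n ] ([ j ≡ᵇ suc i + suc i ]· [ is14 (suc i) ]· 1 * P (n ∸ j))
    ≡⟨ ∑-comm (suc n) n (λ j i → [ j ≡ᵇ suc i + suc i ]· [ is14 (suc i) ]· 1 * P (n ∸ j)) ⟩
  ∑[ i < n ] ∑[ j < suc n ] ([ j ≡ᵇ suc i + suc i ]· [ is14 (suc i) ]· 1 * P (n ∸ j))
    ≡⟨ ∑-cong n (λ i _ → trans (∑-cong (suc n) (λ j _ → []·-*-assoc (j ≡ᵇ suc i + suc i) ([ is14 (suc i) ]· 1) (P (n ∸ j))))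
                                (∑-indicator (suc n) (suc i + suc i) (λ j → [ is14 (suc i) ]· 1 * P (n ∸ j)))) ⟩
  ∑[ i < n ] ([ suc (suc i + suc i) ≤ᵇ suc n ]· ([ is14 (suc i) ]· 1 * P (n ∸ (suc i + suc i))))
    ≡⟨ ∑-cong n (λ i _ → cong₂ [_]·_ (≤ᵇ-suc (suc i + suc i) n) ([]·1-* (is14 (suc i)) _)) ⟩
  ∑[ i < n ] ([ suc i + suc i ≤ᵇ n ]· [ is14 (suc i) ]· P (n ∸ (suc i + suc i)))
    ≡⟨ ∑-cong n (λ i _ → []·-comm (suc i + suc i ≤ᵇ n) (is14 (suc i)) _) ⟩
  ∑[ i < n ] ([ is14 (suc i) ]· [ suc i + suc i ≤ᵇ n ]· P (n ∸ (suc i + suc i))) ∎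

τ : ℕ → ℕ
τ j = τ₁ j + τ₂ j

T-coeffs : HasCoeffs ((mono 4 ⊕ mono 6) ⊛ geom 5 ⊕ (mono 2 ⊕ mono 8) ⊛ geom 10) τ
T-coeffs n = trans (⊕-coeffs (⊛-coeffs (⊕-coeffs (mono-coeffs 4) (mono-coeffs 6)) (geom-coeffs 4))
                             (⊛-coeffs (⊕-coeffs (mono-coeffs 2) (mono-coeffs 8)) (geom-coeffs 9)) n)
                   (cong ℤ.+_ (cong₂ _+_ (two-monomials 4 6 4) (two-monomials 2 8 9)))
  where
  two-monomials : ∀ a b k → ((λ j → monomial a j + monomial b j) ∗ geometric k) n ≡
                            [ a ≤ᵇ n ]· geometric k (n ∸ a) + [ b ≤ᵇ n ]· geometric k (n ∸ b)
  two-monomials a b k = trans (∗-distribʳ-+ (monomial a) (monomial b) (geometric k) n)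
                              (cong₂ _+_ (monomial-∗ a (geometric k) n) (monomial-∗ b (geometric k) n))

allowedProduct-coeffs : HasCoeffs (infProdInv is14) (λ n → allowedCount n n)
allowedProduct-coeffs n = trans (prodL-coeffs (λ i → geom (suc i)) geometric (filter (λ i → is14 (suc i) Bool.≟ true) (upTo n)) geom-coeffs n)
                                (cong ℤ.+_ (∏geometric≡partitionCount is14 n n))

r₂₂≡allowedHooks : ∀ n → r₂₂ n ≡ allowedHooks n n
r₂₂≡allowedHooks n = trans (r-partSum parts14mod5 n) (partSum-cong n n hooks≡)
  where
  hooks≡ : ∀ μ → IsPartition n n μ → [ parts14mod5 μ ]· hooksOfLength 2 μ ≡ [ allParts is14 μ ]· sumAllowedRowHooks μ
  hooks≡ μ μ⊢ rewrite parts14mod5-allParts μ = []·-cong (allParts is14 μ) λ μ∈ →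
    trans (hooksOfLength-topRows 2 μ (IsPartition⇒Descending μ μ⊢)) (sumTopRowHooks-allowed μ μ⊢ μ∈)

allowed∗τ : ∀ n → ((λ N → allowedCount N N) ∗ τ) n ≡ hooksOfParts n n
allowed∗τ n = begin
  (P ∗ τ) n                                         ≡⟨ ∗-comm P τ n ⟩
  (τ ∗ P) n                                         ≡⟨ ∗-distribʳ-+ τ₁ τ₂ P n ⟩
  (τ₁ ∗ P) n + (τ₂ ∗ P) n                           ≡⟨ cong₂ _+_ (τ₁-∗ P n) (τ₂-∗ P n) ⟩
  ∑[ i < n ] ([ is14 (suc i) ]· [ 2 ≤ᵇ suc i ]· P (n ∸ suc i)) + ∑[ i < n ] ([ is14 (suc i) ]· [ suc i + suc i ≤ᵇ n ]· P (n ∸ (suc i + suc i)))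
                                                    ≡⟨ ∑-+ n _ _ ⟨
  ∑[ i < n ] ([ is14 (suc i) ]· [ 2 ≤ᵇ suc i ]· P (n ∸ suc i) + [ is14 (suc i) ]· [ suc i + suc i ≤ᵇ n ]· P (n ∸ (suc i + suc i)))
                                                    ≡⟨ ∑-cong n (λ i i<n → part (suc i) i<n) ⟩
  hooksOfParts n n                                  ∎
  where
  P = λ N → allowedCount N N
  part : ∀ v → v ≤ n → [ is14 v ]· [ 2 ≤ᵇ v ]· P (n ∸ v) + [ is14 v ]· [ v + v ≤ᵇ n ]· P (n ∸ (v + v)) ≡ hooksOfPart v n n
  part v v≤n = begin
    [ is14 v ]· [ 2 ≤ᵇ v ]· P (n ∸ v) + [ is14 v ]· [ v + v ≤ᵇ n ]· P (n ∸ (v + v))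
      ≡⟨ []·-distrib-+ (is14 v) _ _ ⟨
    [ is14 v ]· ([ 2 ≤ᵇ v ]· P (n ∸ v) + [ v + v ≤ᵇ n ]· P (n ∸ (v + v)))
      ≡⟨ cong₂ (λ x y → [ is14 v ]· ([ 2 ≤ᵇ v ]· x + [ v + v ≤ᵇ n ]· y))
           (trans (sym (partSum-bound _ (n ∸ v) n (m∸n≤m n v))) (cong (λ b → [ b ]· allowedCount (n ∸ v) n) (sym (≤ᵇ-true v≤n))))
           (sym (partSum-bound _ (n ∸ (v + v)) n (m∸n≤m n (v + v)))) ⟩
    hooksOfPart v n n ∎

r₂₂-identity : ∀ n → genR r₂₂ n ≡ rhs₂ n
r₂₂-identity n = begin
  ℤ.+ r₂₂ n                  ≡⟨ cong ℤ.+_ (trans (r₂₂≡allowedHooks n) (allowedHooks≡hooksOfParts n n)) ⟩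
  ℤ.+ hooksOfParts n n       ≡⟨ cong ℤ.+_ (allowed∗τ n) ⟨
  ℤ.+ ((λ N → allowedCount N N) ∗ τ) n  ≡⟨ ⊛-coeffs allowedProduct-coeffs T-coeffs n ⟨
  rhs₂ n                     ∎

-- Partitions whose parts differ by at least 2

gap2-∷∷ : ∀ x y ys → gap2 (x ∷ y ∷ ys) ≡ ((y + 2 ≤ᵇ x) ∧ gap2 (y ∷ ys))
gap2-∷∷ x y ys = cong (_∧ gap2 (y ∷ ys)) (isYes≗does ((y + 2) ≤? x))

partsAbove1 : List ℕ → ℕ
partsAbove1 []       = 0
partsAbove1 (y ∷ ys) = [ 2 ≤ᵇ y ]· 1 + partsAbove1 ys

endsIn1 : List ℕ → ℕ
endsIn1 []           = 0
endsIn1 (x ∷ [])     = [ x ≡ᵇ 1 ]· 1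
endsIn1 (x ∷ y ∷ ys) = endsIn1 (y ∷ ys)

sumTopRowHooks-gap : ∀ {n m} λs → IsPartition n m λs → gap2 λs ≡ true → sumTopRowHooks 2 λs ≡ partsAbove1 λs
sumTopRowHooks-gap []           _                       _   = refl
sumTopRowHooks-gap (y ∷ [])     (1≤y , _)               _   = cong (_+ 0) (topRowHooks-2 y [] 1≤y)
sumTopRowHooks-gap (y ∷ z ∷ zs) λ⊢@(1≤y , _ , _ , μ⊢) gap =
  cong₂ _+_ (topRowHooks-2-gap y z zs 1≤y (proj₂ (IsPartition⇒Descending (y ∷ z ∷ zs) λ⊢)) (≤ᵇ-sound z+2≤y))
            (sumTopRowHooks-gap (z ∷ zs) μ⊢ (proj₂ (∧-true {z + 2 ≤ᵇ y} gap′)))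
  where
  gap′ = trans (sym (gap2-∷∷ y z zs)) gap
  z+2≤y = proj₁ (∧-true {z + 2 ≤ᵇ y} gap′)

partsAbove1+endsIn1 : ∀ {n m} λs → IsPartition n m λs → gap2 λs ≡ true → partsAbove1 λs + endsIn1 λs ≡ length λs
partsAbove1+endsIn1 []                   _                       _   = refl
partsAbove1+endsIn1 (suc zero ∷ [])      _                       _   = refl
partsAbove1+endsIn1 (suc (suc y) ∷ [])   _                       _   = refl
partsAbove1+endsIn1 (y ∷ z ∷ zs)         (_ , _ , _ , μ⊢) gap = begin
  [ 2 ≤ᵇ y ]· 1 + partsAbove1 (z ∷ zs) + endsIn1 (z ∷ zs) ≡⟨ cong (λ b → [ b ]· 1 + partsAbove1 (z ∷ zs) + endsIn1 (z ∷ zs)) (≤ᵇ-true 2≤y) ⟩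
  suc (partsAbove1 (z ∷ zs) + endsIn1 (z ∷ zs))           ≡⟨ cong suc (partsAbove1+endsIn1 (z ∷ zs) μ⊢ (proj₂ (∧-true {z + 2 ≤ᵇ y} gap′))) ⟩
  length (y ∷ z ∷ zs)                                     ∎
  where
  gap′ = trans (sym (gap2-∷∷ y z zs)) gap
  2≤y = ≤-trans (m≤n+m 2 z) (≤ᵇ-sound (proj₁ (∧-true {z + 2 ≤ᵇ y} gap′)))

gapSum : (List ℕ → ℕ) → ℕ → ℕ → ℕ → ℕ
gapSum w k = partSum (λ μ → [ gap2 μ ]· [ length μ ≡ᵇ k ]· w μ)

private
  gap-fits : ∀ {y v} → 1 ≤ y → y ≤ v ∸ 2 → y + 2 ≤ v
  gap-fits {y} {suc (suc v)} _   y≤v = subst (y + 2 ≤_) (+-comm v 2) (+-monoˡ-≤ 2 y≤v)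
  gap-fits {suc y} {0}         _ ()
  gap-fits {suc y} {1}         _ ()

  gap-fails : ∀ {y v} → v ∸ 2 < y → ¬ (y + 2 ≤ v)
  gap-fails {y} v∸2<y y+2≤v = <⇒≱ v∸2<y (m+n≤o⇒m≤o∸n y y+2≤v)

partSum-gap2-∷ : ∀ v (w : List ℕ → ℕ) n →
  partSum (λ μ → [ gap2 (v ∷ μ) ]· w μ) n v ≡ partSum (λ μ → [ gap2 μ ]· w μ) n (v ∸ 2)
partSum-gap2-∷ v w n = trans (partSum-restrict (λ μ → [ gap2 (v ∷ μ) ]· w μ) n (v ∸ 2) v (m∸n≤m v 2) too-close)
                             (partSum-cong n (v ∸ 2) far-enough)
  where
  too-close : ∀ μ → IsPartition n v μ → v ∸ 2 < largest μ → [ gap2 (v ∷ μ) ]· w μ ≡ 0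
  too-close (y ∷ ys) _ v∸2<y =
    cong (λ b → [ b ]· w (y ∷ ys)) (trans (gap2-∷∷ v y ys) (cong (_∧ gap2 (y ∷ ys)) (≤ᵇ-false (≰⇒> (gap-fails v∸2<y)))))
  far-enough : ∀ μ → IsPartition n (v ∸ 2) μ → [ gap2 (v ∷ μ) ]· w μ ≡ [ gap2 μ ]· w μ
  far-enough []       _               = refl
  far-enough (y ∷ ys) (1≤y , y≤v∸2 , _) =
    cong (λ b → [ b ]· w (y ∷ ys)) (trans (gap2-∷∷ v y ys) (cong (_∧ gap2 (y ∷ ys)) (≤ᵇ-true (gap-fits 1≤y y≤v∸2))))

gapSum-largest : ∀ w k n m → gapSum w (suc k) n (suc m) ≡
  gapSum w (suc k) n m + [ suc m ≤ᵇ n ]· gapSum (w ∘ (suc m ∷_)) k (n ∸ suc m) (m ∸ 1)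
gapSum-largest w k n m = trans (partSum-largest _ n m)
  (cong (λ x → gapSum w (suc k) n m + [ suc m ≤ᵇ n ]· x) (partSum-gap2-∷ (suc m) (λ μ → [ length μ ≡ᵇ k ]· w (suc m ∷ μ)) (n ∸ suc m)))

gapSum-noParts : ∀ w k n → gapSum w (suc k) n 0 ≡ 0
gapSum-noParts w k zero    = refl
gapSum-noParts w k (suc n) = partSum-noParts (λ μ → [ gap2 μ ]· [ length μ ≡ᵇ suc k ]· w μ) n

gapSum-empty : ∀ w n m → gapSum w 0 n m ≡ [ n ≡ᵇ 0 ]· w []
gapSum-empty w zero    m = +-identityʳ (w [])
gapSum-empty w (suc n) m = partSum-zero (suc n) m nonempty
  where
  nonempty : ∀ μ → IsPartition (suc n) m μ → [ gap2 μ ]· [ length μ ≡ᵇ 0 ]· w μ ≡ 0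
  nonempty (x ∷ μ) _ = []·-zero (gap2 (x ∷ μ))

gapSum-short : ∀ w k n j → j ≤ k + k → gapSum w (suc k) n j ≡ 0
gapSum-short w k       n zero    _   = gapSum-noParts w k n
gapSum-short w (suc k) n (suc j) j<k = begin
  gapSum w (suc (suc k)) n (suc j)                                             ≡⟨ gapSum-largest w (suc k) n j ⟩
  gapSum w (suc (suc k)) n j + [ suc j ≤ᵇ n ]· gapSum _ (suc k) (n ∸ suc j) (j ∸ 1) ≡⟨ cong₂ (λ x y → x + [ suc j ≤ᵇ n ]· y)
                                                                                    (gapSum-short w (suc k) n j (≤-trans (n≤1+n j) j<k))
                                                                                    (gapSum-short _ k (n ∸ suc j) (j ∸ 1) j∸1≤) ⟩
  [ suc j ≤ᵇ n ]· 0                                                            ≡⟨ []·-zero (suc j ≤ᵇ n) ⟩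
  0                                                                            ∎
  where
  j∸1≤ : j ∸ 1 ≤ k + k
  j∸1≤ = ∸-monoˡ-≤ 1 (≤-pred (subst (suc j ≤_) (cong suc (+-suc k k)) j<k))

-- F k n m counts, possibly with a weight, partitions of n into k + 1 parts at most m that differ
-- by at least 2. Their least sum is (k + 1)² = 1 + 3 + ⋯ + (2k + 1), and removing this staircase
-- leaves an arbitrary partition into at most k + c parts.
staircase : ∀ (F : ℕ → ℕ → ℕ → ℕ) c →
  (∀ k n m → F (suc k) n (suc m) ≡ F (suc k) n m + [ suc m ≤ᵇ n ]· F k (n ∸ suc m) (m ∸ 1)) →
  (∀ k n → F (suc k) n (suc k + suc k + 0) ≡ 0) →
  (∀ n M → F 0 n (suc M) ≡ [ 1 ≤ᵇ n ]· boxCount (n ∸ 1) M c) →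
  ∀ k M n → F k n (suc (k + k + M)) ≡ [ suc k * suc k ≤ᵇ n ]· boxCount (n ∸ suc k * suc k) M (k + c)
staircase F c F-rec F-short F-one = go
  where
  go : ∀ k M n → F k n (suc (k + k + M)) ≡ [ suc k * suc k ≤ᵇ n ]· boxCount (n ∸ suc k * suc k) M (k + c)
  go zero    M       n = F-one n M
  go (suc k) zero    n = begin
    F (suc k) n (suc m)
      ≡⟨ F-rec k n m ⟩
    F (suc k) n m + [ suc m ≤ᵇ n ]· F k (n ∸ suc m) (m ∸ 1)
      ≡⟨ cong₂ (λ x y → x + [ suc m ≤ᵇ n ]· y) (F-short k n)
           (trans (cong (F k (n ∸ suc m)) (cong (_+ 0) (+-suc k k))) (go k 0 (n ∸ suc m))) ⟩
    [ suc m ≤ᵇ n ]· [ K ≤ᵇ n ∸ suc m ]· boxCount (n ∸ suc m ∸ K) 0 (k + c)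
      ≡⟨ cong (λ x → [ suc m ≤ᵇ n ]· [ K ≤ᵇ n ∸ suc m ]· x) (empty (n ∸ suc m ∸ K)) ⟩
    [ suc m ≤ᵇ n ]· [ K ≤ᵇ n ∸ suc m ]· boxCount (n ∸ suc m ∸ K) 0 (suc k + c)
      ≡⟨ []·-shift-merge (suc m) K K₂ n (λ x → boxCount x 0 (suc k + c)) square ⟩
    [ K₂ ≤ᵇ n ]· boxCount (n ∸ K₂) 0 (suc k + c) ∎
    where
    m = suc k + suc k + 0
    K = suc k * suc k
    K₂ = suc (suc k) * suc (suc k)
    square : suc m + K ≡ K₂
    square = solve 1 (λ k → con 1 :+ ((con 1 :+ k) :+ (con 1 :+ k) :+ con 0) :+ (con 1 :+ k) :* (con 1 :+ k)
                          := (con 2 :+ k) :* (con 2 :+ k)) refl k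
    empty : ∀ x → boxCount x 0 (k + c) ≡ boxCount x 0 (suc k + c)
    empty x = trans (boxCount-noColumns x (k + c)) (sym (boxCount-noColumns x (suc k + c)))
  go (suc k) (suc M) n = begin
    F (suc k) n (suc m)
      ≡⟨ F-rec k n m ⟩
    F (suc k) n m + [ suc m ≤ᵇ n ]· F k (n ∸ suc m) (m ∸ 1)
      ≡⟨ cong₂ (λ x y → x + [ suc m ≤ᵇ n ]· y)
           (trans (cong (F (suc k) n) (+-suc (suc k + suc k) M)) (go (suc k) M n))
           (trans (cong (F k (n ∸ suc m)) (cong (_+ suc M) (+-suc k k))) (go k (suc M) (n ∸ suc m))) ⟩
    [ K₂ ≤ᵇ n ]· boxCount (n ∸ K₂) M (suc k + c) + [ suc m ≤ᵇ n ]· [ K ≤ᵇ n ∸ suc m ]· boxCount (n ∸ suc m ∸ K) (suc M) (k + c)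
      ≡⟨ cong ([ K₂ ≤ᵇ n ]· boxCount (n ∸ K₂) M (suc k + c) +_)
           (trans ([]·-shift-merge (suc m) K (K₂ + suc M) n shorter square) ([]·-shift-+ K₂ (suc M) n shorter)) ⟩
    [ K₂ ≤ᵇ n ]· boxCount (n ∸ K₂) M (suc k + c) + [ K₂ ≤ᵇ n ]· [ suc M ≤ᵇ n ∸ K₂ ]· shorter (n ∸ K₂ ∸ suc M)
      ≡⟨ []·-distrib-+ (K₂ ≤ᵇ n) _ _ ⟨
    [ K₂ ≤ᵇ n ]· (boxCount (n ∸ K₂) M (suc k + c) + [ suc M ≤ᵇ n ∸ K₂ ]· shorter (n ∸ K₂ ∸ suc M))
      ≡⟨ cong ([ K₂ ≤ᵇ n ]·_) (boxCount-largest (n ∸ K₂) M (k + c)) ⟨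
    [ K₂ ≤ᵇ n ]· boxCount (n ∸ K₂) (suc M) (suc k + c) ∎
    where
    m = suc k + suc k + suc M
    K = suc k * suc k
    K₂ = suc (suc k) * suc (suc k)
    shorter = λ x → boxCount x (suc M) (k + c)
    square : suc m + K ≡ K₂ + suc M
    square = solve 2 (λ k M → con 1 :+ ((con 1 :+ k) :+ (con 1 :+ k) :+ (con 1 :+ M)) :+ (con 1 :+ k) :* (con 1 :+ k)
                            := (con 2 :+ k) :* (con 2 :+ k) :+ (con 1 :+ M)) refl k M

gapCount gapCount1 : ℕ → ℕ → ℕ → ℕ
gapCount  = gapSum (λ _ → 1)
gapCount1 = gapSum endsIn1

gapCount-one : ∀ n M → gapCount 1 n (suc M) ≡ [ 1 ≤ᵇ n ]· boxCount (n ∸ 1) M 1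
gapCount-one n zero    = begin
  gapCount 1 n 1
    ≡⟨ gapSum-largest (λ _ → 1) 0 n 0 ⟩
  gapCount 1 n 0 + [ 1 ≤ᵇ n ]· gapCount 0 (n ∸ 1) 0
    ≡⟨ cong₂ (λ x y → x + [ 1 ≤ᵇ n ]· y) (gapSum-noParts (λ _ → 1) 0 n)
         (trans (gapSum-empty (λ _ → 1) (n ∸ 1) 0) (sym (boxCount-noColumns (n ∸ 1) 1))) ⟩
  [ 1 ≤ᵇ n ]· boxCount (n ∸ 1) 0 1 ∎
gapCount-one n (suc M) = begin
  gapCount 1 n (2 + M)
    ≡⟨ gapSum-largest (λ _ → 1) 0 n (suc M) ⟩
  gapCount 1 n (suc M) + [ 2 + M ≤ᵇ n ]· gapCount 0 (n ∸ (2 + M)) M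
    ≡⟨ cong₂ (λ x y → x + [ 2 + M ≤ᵇ n ]· y) (gapCount-one n M) (gapSum-empty (λ _ → 1) (n ∸ (2 + M)) M) ⟩
  [ 1 ≤ᵇ n ]· boxCount (n ∸ 1) M 1 + [ 2 + M ≤ᵇ n ]· monomial 0 (n ∸ (2 + M))
    ≡⟨ cong ([ 1 ≤ᵇ n ]· boxCount (n ∸ 1) M 1 +_) ([]·-shift-merge 1 (suc M) (2 + M) n (monomial 0) refl) ⟨
  [ 1 ≤ᵇ n ]· boxCount (n ∸ 1) M 1 + [ 1 ≤ᵇ n ]· [ suc M ≤ᵇ n ∸ 1 ]· monomial 0 (n ∸ 1 ∸ suc M)
    ≡⟨ []·-distrib-+ (1 ≤ᵇ n) _ _ ⟨
  [ 1 ≤ᵇ n ]· (boxCount (n ∸ 1) M 1 + [ suc M ≤ᵇ n ∸ 1 ]· monomial 0 (n ∸ 1 ∸ suc M))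
    ≡⟨ cong (λ x → [ 1 ≤ᵇ n ]· (boxCount (n ∸ 1) M 1 + [ suc M ≤ᵇ n ∸ 1 ]· x)) (boxCount-noRows (n ∸ 1 ∸ suc M) (suc M)) ⟨
  [ 1 ≤ᵇ n ]· (boxCount (n ∸ 1) M 1 + [ suc M ≤ᵇ n ∸ 1 ]· boxCount (n ∸ 1 ∸ suc M) (suc M) 0)
    ≡⟨ cong ([ 1 ≤ᵇ n ]·_) (boxCount-largest (n ∸ 1) M 0) ⟨
  [ 1 ≤ᵇ n ]· boxCount (n ∸ 1) (suc M) 1 ∎

gapCount1-one : ∀ n M → gapCount1 1 n (suc M) ≡ [ 1 ≤ᵇ n ]· boxCount (n ∸ 1) M 0
gapCount1-one n zero    = begin
  gapCount1 1 n 1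
    ≡⟨ gapSum-largest endsIn1 0 n 0 ⟩
  gapCount1 1 n 0 + [ 1 ≤ᵇ n ]· gapSum (endsIn1 ∘ (1 ∷_)) 0 (n ∸ 1) 0
    ≡⟨ cong₂ (λ x y → x + [ 1 ≤ᵇ n ]· y) (gapSum-noParts endsIn1 0 n)
         (trans (gapSum-empty (endsIn1 ∘ (1 ∷_)) (n ∸ 1) 0) (sym (boxCount-noRows (n ∸ 1) 0))) ⟩
  [ 1 ≤ᵇ n ]· boxCount (n ∸ 1) 0 0 ∎
gapCount1-one n (suc M) = begin
  gapCount1 1 n (2 + M)
    ≡⟨ gapSum-largest endsIn1 0 n (suc M) ⟩
  gapCount1 1 n (suc M) + [ 2 + M ≤ᵇ n ]· gapSum (endsIn1 ∘ (2 + M ∷_)) 0 (n ∸ (2 + M)) M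
    ≡⟨ cong₂ (λ x y → x + [ 2 + M ≤ᵇ n ]· y) (gapCount1-one n M)
         (trans (gapSum-empty (endsIn1 ∘ (2 + M ∷_)) (n ∸ (2 + M)) M) ([]·-zero (n ∸ (2 + M) ≡ᵇ 0))) ⟩
  [ 1 ≤ᵇ n ]· boxCount (n ∸ 1) M 0 + [ 2 + M ≤ᵇ n ]· 0
    ≡⟨ cong₂ _+_ (cong ([ 1 ≤ᵇ n ]·_) (trans (boxCount-noRows (n ∸ 1) M) (sym (boxCount-noRows (n ∸ 1) (suc M)))))
                 ([]·-zero (2 + M ≤ᵇ n)) ⟩
  [ 1 ≤ᵇ n ]· boxCount (n ∸ 1) (suc M) 0 + 0
    ≡⟨ +-identityʳ _ ⟩
  [ 1 ≤ᵇ n ]· boxCount (n ∸ 1) (suc M) 0 ∎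

gapCount-staircase : ∀ k M n → gapCount (suc k) n (suc (k + k + M)) ≡ [ suc k * suc k ≤ᵇ n ]· boxCount (n ∸ suc k * suc k) M (k + 1)
gapCount-staircase = staircase (gapCount ∘ suc) 1 (λ k → gapSum-largest (λ _ → 1) (suc k))
  (λ k n → gapSum-short (λ _ → 1) (suc k) n _ (≤-reflexive (+-identityʳ _))) gapCount-one

gapCount1-staircase : ∀ k M n → gapCount1 (suc k) n (suc (k + k + M)) ≡ [ suc k * suc k ≤ᵇ n ]· boxCount (n ∸ suc k * suc k) M (k + 0)
gapCount1-staircase = staircase (gapCount1 ∘ suc) 0 rec (λ k n → gapSum-short endsIn1 (suc k) n _ (≤-reflexive (+-identityʳ _))) gapCount1-one
  where
  rec : ∀ k n m → gapCount1 (2 + k) n (suc m) ≡ gapCount1 (2 + k) n m + [ suc m ≤ᵇ n ]· gapCount1 (suc k) (n ∸ suc m) (m ∸ 1)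
  rec k n m = trans (gapSum-largest endsIn1 (suc k) n m)
    (cong (λ x → gapCount1 (2 + k) n m + [ suc m ≤ᵇ n ]· x) (partSum-cong (n ∸ suc m) (m ∸ 1) below))
    where
    below : ∀ μ → IsPartition (n ∸ suc m) (m ∸ 1) μ →
      [ gap2 μ ]· [ length μ ≡ᵇ suc k ]· endsIn1 (suc m ∷ μ) ≡ [ gap2 μ ]· [ length μ ≡ᵇ suc k ]· endsIn1 μ
    below []      _ = refl
    below (_ ∷ _) _ = refl

private
  staircase-diagonal : ∀ (G : ℕ → ℕ → ℕ) k j →
    (∀ M n → G n (suc (k + k + M)) ≡ [ suc k * suc k ≤ᵇ n ]· boxCount (n ∸ suc k * suc k) M j) →
    (∀ n → n ≤ k + k → G n n ≡ 0) →
    ∀ n → G n n ≡ [ suc k * suc k ≤ᵇ n ]· p≤ (n ∸ suc k * suc k) j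
  odd<square : ∀ k → suc (k + k) ≤ suc k * suc k
  odd<square k = s≤s (+-monoʳ-≤ k (m≤m*n k (suc k)))

  staircase-diagonal G k j G-stairs G-short n with suc (k + k) ≤? n
  ... | yes 2k<n = begin
    G n n                                         ≡⟨ cong (G n) (m+[n∸m]≡n 2k<n) ⟨
    G n (suc (k + k + M))                         ≡⟨ G-stairs M n ⟩
    [ K ≤ᵇ n ]· boxCount (n ∸ K) M j              ≡⟨ cong ([ K ≤ᵇ n ]·_)
                                                       (partSum-bound (λ μ → [ length μ ≤ᵇ j ]· 1) (n ∸ K) M (∸-monoʳ-≤ n (odd<square k))) ⟩
    [ K ≤ᵇ n ]· boxCount (n ∸ K) (n ∸ K) j        ≡⟨ cong ([ K ≤ᵇ n ]·_) (boxCount-conjugate (n ∸ K) j) ⟩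
    [ K ≤ᵇ n ]· p≤ (n ∸ K) j                      ∎
    where
    M = n ∸ suc (k + k)
    K = suc k * suc k
  ... | no  2k≮n = begin
    G n n                                         ≡⟨ G-short n (≤-pred (≰⇒> 2k≮n)) ⟩
    0                                             ≡⟨ cong (λ b → [ b ]· p≤ (n ∸ suc k * suc k) j) (≤ᵇ-false (≤-trans (≰⇒> 2k≮n) (odd<square k))) ⟨
    [ suc k * suc k ≤ᵇ n ]· p≤ (n ∸ suc k * suc k) j ∎

gapCount-diagonal : ∀ k n → gapCount (suc k) n n ≡ [ suc k * suc k ≤ᵇ n ]· p≤ (n ∸ suc k * suc k) (suc k)
gapCount-diagonal k = staircase-diagonal (λ n → gapCount (suc k) n) k (suc k)
  (λ M n → trans (gapCount-staircase k M n) (cong (λ j → [ suc k * suc k ≤ᵇ n ]· boxCount (n ∸ suc k * suc k) M j) (+-comm k 1)))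
  (λ n → gapSum-short (λ _ → 1) k n n)

gapCount1-diagonal : ∀ k n → gapCount1 (suc k) n n ≡ [ suc k * suc k ≤ᵇ n ]· p≤ (n ∸ suc k * suc k) k
gapCount1-diagonal k = staircase-diagonal (λ n → gapCount1 (suc k) n) k k
  (λ M n → trans (gapCount1-staircase k M n) (cong (λ j → [ suc k * suc k ≤ᵇ n ]· boxCount (n ∸ suc k * suc k) M j) (+-identityʳ k)))
  (λ n → gapSum-short endsIn1 k n n)

gapSum-byLength : ∀ w n → partSum (λ μ → [ gap2 μ ]· w μ) n n ≡ ∑[ k < suc n ] gapSum w k n n
gapSum-byLength w n = trans (partSum-byLength (λ μ → [ gap2 μ ]· w μ) n)
  (∑-cong (suc n) (λ k _ → partSum-cong n n (λ μ _ → []·-comm (length μ ≡ᵇ k) (gap2 μ) (w μ))))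

gapSum-length : ∀ k n → gapSum length k n n ≡ k * gapCount k n n
gapSum-length k n = trans (partSum-cong n n counted) (partSum-*ˡ k (λ μ → [ gap2 μ ]· [ length μ ≡ᵇ k ]· 1) n n)
  where
  counted : ∀ μ → IsPartition n n μ → [ gap2 μ ]· [ length μ ≡ᵇ k ]· length μ ≡ k * [ gap2 μ ]· [ length μ ≡ᵇ k ]· 1
  counted μ _ with gap2 μ | length μ ≡ᵇ k in len≡ᵇk
  ... | false | _     = sym (*-zeroʳ k)
  ... | true  | false = sym (*-zeroʳ k)
  ... | true  | true  = trans (≡ᵇ-sound len≡ᵇk) (sym (*-identityʳ k))

r₁₂+endsIn1≡parts : ∀ n → r₁₂ n + ∑[ k < n ] gapCount1 (suc k) n n ≡ ∑[ k < n ] (suc k * gapCount (suc k) n n)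
r₁₂+endsIn1≡parts n = begin
  r₁₂ n + ∑[ k < n ] gapCount1 (suc k) n n
    ≡⟨ cong₂ _+_ (trans (r-partSum gap2 n) (partSum-cong n n hooks≡))
                 (cong (_+ ∑[ k < n ] gapCount1 (suc k) n n) (sym (trans (gapSum-empty endsIn1 n n) ([]·-zero (n ≡ᵇ 0))))) ⟩
  partSum (λ μ → [ gap2 μ ]· partsAbove1 μ) n n + (gapCount1 0 n n + ∑[ k < n ] gapCount1 (suc k) n n)
    ≡⟨ cong (partSum (λ μ → [ gap2 μ ]· partsAbove1 μ) n n +_) (gapSum-byLength endsIn1 n) ⟨
  partSum (λ μ → [ gap2 μ ]· partsAbove1 μ) n n + partSum (λ μ → [ gap2 μ ]· endsIn1 μ) n n
    ≡⟨ partSum-+ (λ μ → [ gap2 μ ]· partsAbove1 μ) (λ μ → [ gap2 μ ]· endsIn1 μ) n n ⟨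
  partSum (λ μ → [ gap2 μ ]· partsAbove1 μ + [ gap2 μ ]· endsIn1 μ) n n
    ≡⟨ partSum-cong n n (λ μ μ⊢ → trans (sym ([]·-distrib-+ (gap2 μ) _ _)) ([]·-cong (gap2 μ) (partsAbove1+endsIn1 μ μ⊢))) ⟩
  partSum (λ μ → [ gap2 μ ]· length μ) n n
    ≡⟨ gapSum-byLength length n ⟩
  ∑[ k < suc n ] gapSum length k n n
    ≡⟨ ∑-cong (suc n) (λ k _ → gapSum-length k n) ⟩
  ∑[ k < n ] (suc k * gapCount (suc k) n n) ∎
  where
  hooks≡ : ∀ μ → IsPartition n n μ → [ gap2 μ ]· hooksOfLength 2 μ ≡ [ gap2 μ ]· partsAbove1 μ
  hooks≡ μ μ⊢ = []·-cong (gap2 μ) λ gap →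
    trans (hooksOfLength-topRows 2 μ (IsPartition⇒Descending μ μ⊢)) (sumTopRowHooks-gap μ μ⊢ gap)

term₁-coeffs : ∀ k → HasCoeffs (term₁ (suc k)) (λ n → suc k * gapCount (suc k) n n)
term₁-coeffs k n = begin
  term₁ (suc k) n                                         ≡⟨ scale-coeffs (suc k) (⊛-coeffs (mono-coeffs K) (invPoch-coeffs (suc k))) n ⟩
  ℤ.+ (suc k * (monomial K ∗ (λ x → p≤ x (suc k))) n)     ≡⟨ cong (λ x → ℤ.+ (suc k * x)) (monomial-∗ K (λ x → p≤ x (suc k)) n) ⟩
  ℤ.+ (suc k * [ K ≤ᵇ n ]· p≤ (n ∸ K) (suc k))            ≡⟨ cong (λ x → ℤ.+ (suc k * x)) (gapCount-diagonal k n) ⟨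
  ℤ.+ (suc k * gapCount (suc k) n n)                      ∎
  where K = suc k * suc k

term₂-coeffs : ∀ k → HasCoeffs (term₂ (suc k)) (λ n → gapCount1 (suc k) n n)
term₂-coeffs k n = begin
  term₂ (suc k) n                                 ≡⟨ ⊛-coeffs (mono-coeffs K) (invPoch-coeffs k) n ⟩
  ℤ.+ (monomial K ∗ (λ x → p≤ x k)) n             ≡⟨ cong ℤ.+_ (monomial-∗ K (λ x → p≤ x k) n) ⟩
  ℤ.+ [ K ≤ᵇ n ]· p≤ (n ∸ K) k                    ≡⟨ cong ℤ.+_ (gapCount1-diagonal k n) ⟨
  ℤ.+ gapCount1 (suc k) n n                       ∎
  where K = suc k * suc k

r₁₂-identity : ∀ n → genR r₁₂ n ≡ rhs₁ n
r₁₂-identity n = sym (begin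
  infSum term₁ n ℤ.- infSum term₂ n
    ≡⟨ cong₂ ℤ._-_ (infSum-coeffs term₁ _ const-zero-coeffs term₁-coeffs n) (infSum-coeffs term₂ _ const-zero-coeffs term₂-coeffs n) ⟩
  ℤ.+ ∑[ k < n ] (suc k * gapCount (suc k) n n) ℤ.- ℤ.+ ∑[ k < n ] gapCount1 (suc k) n n
    ≡⟨ +-minus (sym (r₁₂+endsIn1≡parts n)) ⟩
  ℤ.+ r₁₂ n ∎)

proposition3p2 : ((n : ℕ) → genR r₁₂ n ≡ rhs₁ n) × ((n : ℕ) → genR r₂₂ n ≡ rhs₂ n)
proposition3p2 = r₁₂-identity , r₂₂-identity
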